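{- Let $1\le m\le n$. For $-1\le i\le\min\{m,n-m\}$, let $\Delta^i_n$ be the family of matchings in $\mathsf{M}_n$ containing at most $i$ edges $ab$ with $a\in[m]$ and $b\in[m+1,n]$ (so $\Delta^{ -1}_n=\emptyset$, the empty family). Then for $0\le i\le\min\{m,n-m\}$ and all $d$, \[\tilde H_d(\Delta^i_n,\Delta^{i-1}_n)\cong\bigoplus\langle a_1b_1\wedge\cdots\wedge a_ib_i\rangle\otimes\tilde H_{d-i}\big(\mathsf{M}[[m]\setminus A]*\mathsf{M}[[m+1,n]\setminus B]\big),\] where the sum ranges over all pairs of sequences $(a_1,\dots,a_i)$ and $(b_1,\dots,b_i)$ with $1\le a_1<\cdots<a_i\le m$ and $b_1,\dots,b_i$ distinct elements of $[m+1,n]$, and $A=\{a_1,\dots,a_i\}$, $B=\{b_1,\dots,b_i\}$.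
   Context: For a finite set $S$, $\mathsf{M}[S]$ is the matching complex of the complete graph on $S$ (vertices: edges $ab=\{a,b\}$; faces: matchings); $\mathsf{M}_n=\mathsf{M}[[n]]$, $[n]=\{1,\dots,n\}$, $[a,b]=\{a,\dots,b\}$. The join of families $\Delta,\Sigma$ on disjoint ground sets is $\Delta*\Sigma=\{\delta\cup\sigma:\delta\in\Delta,\sigma\in\Sigma\}$. Homology is reduced simplicial homology with coefficients in an arbitrary ring with unit. The notation $\langle\sigma\rangle\otimes H$ denotes a copy of the group $H$ indexed by the (oriented) set of edges $\sigma$. -}

module Defs where

open import Level using (Level; _⊔_) renaming (suc to lsuc)
open import Algebra.Bundles using (Ring)
open import Data.Bool using (Bool; true; false; _∧_; _∨_; not; T; if_then_else_)
open import Data.Nat as ℕ using (ℕ; zero; suc; _<ᵇ_; _≤ᵇ_)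
open import Data.Integer as ℤ using (ℤ; +_; -[1+_])
open import Data.Fin using (Fin; toℕ; remQuot)
open import Data.Vec using (Vec; []; _∷_; toList)
open import Data.List as List using (List; []; _∷_)
open import Data.Product using (Σ; _×_; _,_; proj₁; proj₂)
open import Data.Unit.Polymorphic using (⊤)

incr : ∀ {N k} → Vec (Fin N) k → Bool
incr []            = true
incr (x ∷ [])      = true
incr (x ∷ y ∷ xs)  = (toℕ x <ᵇ toℕ y) ∧ incr (y ∷ xs)

-- a (finite) family of faces on the vertex set Fin N, given by a decidable
-- (Bool-valued) membership predicate on (sorted) lists of vertices
Family : ℕ → Set
Family N = List (Fin N) → Bool

-- "Raw" R-modules presented via a partial equivalence relation (PER):
-- the elements of the module are the ~-classes of elements x with x ~ x.
-- (Quotients do not exist in Agda without cubical; this is the standard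
-- setoid/PER rendering.)

module _ {c ℓ : Level} (R : Ring c ℓ) where
  private module R = Ring R

  record PERModule (a b : Level) : Set (c ⊔ lsuc (a ⊔ b)) where
    field
      Car  : Set a
      _~_  : Car → Car → Set b
      _⊕_  : Car → Car → Car
      _·_  : R.Carrier → Car → Car

  record _≅_ {a b a' b'} (M : PERModule a b) (N : PERModule a' b')
         : Set (c ⊔ a ⊔ b ⊔ a' ⊔ b') where
    private
      module M = PERModule M
      module N = PERModule N
    field
      to       : M.Car → N.Car
      from     : N.Car → M.Car
      to-cong  : ∀ {x y} → M._~_ x y → N._~_ (to x) (to y)
      from-cong : ∀ {x y} → N._~_ x y → M._~_ (from x) (from y)
      from-to  : ∀ {x} → M._~_ x x → M._~_ (from (to x)) x
      to-from  : ∀ {y} → N._~_ y y → N._~_ (to (from y)) y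
      to-⊕     : ∀ {x y} → M._~_ x x → M._~_ y y →
                 N._~_ (to (M._⊕_ x y)) (N._⊕_ (to x) (to y))
      to-·     : ∀ r {x} → M._~_ x x → N._~_ (to (M._·_ r x)) (N._·_ r (to x))

  open R using (Carrier; 0#; 1#; -_) renaming (_+_ to _+R_; _*_ to _*R_; _≈_ to _≈R_)

  _-R_ : Carrier → Carrier → Carrier
  x -R y = x +R (- y)

  sgn : ℕ → Carrier
  sgn zero    = 1#
  sgn (suc n) = - sgn n

  sumFin : ∀ {N} → (Fin N → Carrier) → Carrier
  sumFin {zero}  f = 0#
  sumFin {suc N} f = f Fin.zero +R sumFin (λ i → f (Fin.suc i))
    where import Data.Fin as Fin

  -- k-chains: functions on ordered (k)-vertex lists; only values on the
  -- relative faces (see `ok`) matter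
  Chain : ℕ → ℕ → Set c
  Chain N k = Vec (Fin N) k → Carrier

  ins : ∀ {N k} → Fin N → Vec (Fin N) k → Vec (Fin N) (suc k)
  ins v []       = v ∷ []
  ins v (x ∷ xs) = if toℕ x <ᵇ toℕ v then x ∷ ins v xs else v ∷ x ∷ xs

  below : ∀ {N k} → Fin N → Vec (Fin N) k → ℕ
  below v []       = 0
  below v (x ∷ xs) = if toℕ x <ᵇ toℕ v then suc (below v xs) else 0

  module Rel {N : ℕ} (Δ Γ : Family N) where

    -- σ is an (oriented-by-sorting) face of Δ not in Γ: a basis element
    -- of the relative chain group C(Δ,Γ) = C(Δ)/C(Γ)
    ok : ∀ {k} → Vec (Fin N) k → Bool
    ok σ = incr σ ∧ Δ (toList σ) ∧ not (Γ (toList σ))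

    _≈C_ : ∀ {k} → Chain N k → Chain N k → Set ℓ
    c ≈C c' = ∀ σ → T (ok σ) → c σ ≈R c' σ

    -- relative boundary  ∂ : C_{k} → C_{k-1}  (faces with k+1 ↦ k vertices);
    -- ∂[τ₀…τ_k] = Σ_j (-1)^j [τ₀…τ̂_j…τ_k]
    ∂ : ∀ {k} → Chain N (suc k) → Chain N k
    ∂ c σ = sumFin (λ v → if ok (ins v σ)
                           then sgn (below v σ) *R c (ins v σ)
                           else 0#)

    IsCycle : ∀ k → Chain N k → Set ℓ
    IsCycle zero    c = ⊤
    IsCycle (suc k) c = ∂ c ≈C (λ _ → 0#)

    -- homology in degree k-1 (chains on k-vertex faces), as a PER module
    Hsize : ℕ → PERModule (c ⊔ ℓ) (c ⊔ ℓ)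
    Hsize k = record
      { Car = Lift′ (Chain N k)
      ; _~_ = λ x y → IsCycle k (lower x) × IsCycle k (lower y)
                      × Σ (Chain N (suc k)) (λ e →
                          (λ σ → lower x σ -R lower y σ) ≈C ∂ e)
      ; _⊕_ = λ x y → lift (λ σ → lower x σ +R lower y σ)
      ; _·_ = λ r x → lift (λ σ → r *R lower x σ)
      }
      where open import Level using (Lift; lift; lower)
            Lift′ : Set c → Set (c ⊔ ℓ)
            Lift′ A = Lift ℓ A

    trivial : PERModule (c ⊔ ℓ) (c ⊔ ℓ)
    trivial = record { Car = ⊤ ; _~_ = λ _ _ → ⊤ ; _⊕_ = λ _ _ → _ ; _·_ = λ _ _ → _ }

    H̃ : ℤ → PERModule (c ⊔ ℓ) (c ⊔ ℓ)
    H̃ (+ d)          = Hsize (suc d)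
    H̃ -[1+ zero ]    = Hsize zero
    H̃ -[1+ suc _ ]   = trivial

  H̃abs : ∀ {N} → Family N → ℤ → PERModule (c ⊔ ℓ) (c ⊔ ℓ)
  H̃abs Δ = Rel.H̃ Δ (λ _ → false)

  -- (finite) direct sum ⊕_{x ∈ I, valid x} M x ; for a finite index set
  -- this is the product, whose elements are families indexed by the valid x
  ⨁ : ∀ {i p} (I : Set i) (Valid : I → Set p) →
      (I → PERModule (c ⊔ ℓ) (c ⊔ ℓ)) → PERModule (c ⊔ ℓ ⊔ i) (c ⊔ ℓ ⊔ i ⊔ p)
  ⨁ I Valid M = record
    { Car = (x : I) → PERModule.Car (M x)
    ; _~_ = λ f g → ∀ x → Valid x → PERModule._~_ (M x) (f x) (g x)
    ; _⊕_ = λ f g x → PERModule._⊕_ (M x) (f x) (g x)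
    ; _·_ = λ r f x → PERModule._·_ (M x) r (f x)
    }

-- The point j ∈ [n] is encoded as (j-1) : Fin n; a
-- vertex of the complete graph K_n (an edge ab, a<b) is encoded as
-- e : Fin (n * n) with remQuot n e = (a , b); codes with a ≥ b are
-- not vertices of any of the complexes below (they lie in no face).

edge : ∀ n → Fin (n ℕ.* n) → Fin n × Fin n
edge n e = remQuot n e

isEdge : ∀ n → Fin (n ℕ.* n) → Bool
isEdge n e = toℕ (proj₁ (edge n e)) <ᵇ toℕ (proj₂ (edge n e))

_==_ : ℕ → ℕ → Bool
x == y = (x ≤ᵇ y) ∧ (y ≤ᵇ x)

meet : ∀ n → Fin (n ℕ.* n) → Fin (n ℕ.* n) → Bool
meet n e f = let (a , b) = edge n e ; (a' , b') = edge n f in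
  (toℕ a == toℕ a') ∨ (toℕ a == toℕ b') ∨ (toℕ b == toℕ a') ∨ (toℕ b == toℕ b')

all : ∀ {A : Set} → (A → Bool) → List A → Bool
all p []       = true
all p (x ∷ xs) = p x ∧ all p xs

isMatching : ∀ n → List (Fin (n ℕ.* n)) → Bool
isMatching n []       = true
isMatching n (e ∷ σ)  = isEdge n e ∧ all (λ f → not (meet n e f)) σ ∧ isMatching n σ

cross : ∀ n → ℕ → List (Fin (n ℕ.* n)) → ℕ
cross n m []      = 0
cross n m (e ∷ σ) =
  (if (toℕ (proj₁ (edge n e)) <ᵇ m) ∧ (m ≤ᵇ toℕ (proj₂ (edge n e))) then 1 else 0)
  ℕ.+ cross n m σ

Δ : (n m : ℕ) → ℤ → Family (n ℕ.* n)
Δ n m i σ = isMatching n σ ∧ (+ (cross n m σ) ℤ.≤ᵇ i)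

elem : ∀ {n k} → Fin n → Vec (Fin n) k → Bool
elem x []       = false
elem x (y ∷ ys) = (toℕ x == toℕ y) ∨ elem x ys

-- the join  M[[m] ∖ A] * M[[m+1,n] ∖ B]  as a family on the edges of K_n:
-- matchings all of whose edges lie in [m]∖A or in [m+1,n]∖B
Join : (n m : ℕ) → ∀ {k} → Vec (Fin n) k → Vec (Fin n) k → Family (n ℕ.* n)
Join n m A B σ = isMatching n σ ∧ all ok σ
  where
  inL inR : Fin n → Bool
  inL x = (toℕ x <ᵇ m) ∧ not (elem x A)
  inR x = (m ≤ᵇ toℕ x) ∧ not (elem x B)
  ok : Fin (n ℕ.* n) → Bool
  ok e = (inL (proj₁ (edge n e)) ∧ inL (proj₂ (edge n e)))
       ∨ (inR (proj₁ (edge n e)) ∧ inR (proj₂ (edge n e)))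

distinct : ∀ {n k} → Vec (Fin n) k → Bool
distinct []       = true
distinct (x ∷ xs) = not (elem x xs) ∧ distinct xs

allV : ∀ {A : Set} {k} → (A → Bool) → Vec A k → Bool
allV p []       = true
allV p (x ∷ xs) = p x ∧ allV p xs

ValidAB : (n m : ℕ) → ∀ {k} → Vec (Fin n) k × Vec (Fin n) k → Set
ValidAB n m (A , B) =
  T (incr A ∧ allV (λ a → toℕ a <ᵇ m) A ∧ allV (λ b → m ≤ᵇ toℕ b) B ∧ distinct B)

module Submission where

-- A relative face of (Δ^i , Δ^(i-1)) is a matching σ with exactly i crossing
-- edges.  Its crossing edges S = {a₁b₁,…,a_ib_i}, listed with a₁ < ⋯ < a_i,
-- form a valid pair (A , B), and ρ = σ ∖ S is a face of the join
-- J(A,B) = M[[m]∖A] * M[[m+1,n]∖B]; conversely S ∪ ρ is a relative face for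
-- every face ρ of J(A,B).  Removing a crossing edge from σ lands in
-- Δ^(i-1), i.e. gives zero in the relative complex, so the relative boundary
-- of S ∪ ρ is S ∪ ∂ρ up to the sign (-1)^#{(s , r) ∈ S × ρ | s < r}.  Hence
-- the relative chain complex is, up to these signs and a shift by i, the
-- direct sum of the chain complexes of the joins, and so is its homology.
--
-- The isomorphism holds for every i; the hypotheses on m and i
-- are only used to know n ≥ 1, which provides padding vertices.

open import Defs
open import Level using (Level; _⊔_; lift; lower)
open import Algebra.Bundles using (Ring)
import Algebra.Solver.CommutativeMonoid as CMSolver
open import Data.Bool using (Bool; true; false; _∧_; _∨_; not; T; if_then_else_; T?)
open import Data.Bool.Properties
  using (T-∧; T-∨; T-≡; ∧-assoc; ∧-identityʳ; ∧-zeroʳ; ∧-commutativeMonoid; ∨-commutativeMonoid)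
open import Data.Unit using (tt)
open import Data.Empty using (⊥-elim)
open import Data.Nat as ℕ using (ℕ; zero; suc; _+_; _<ᵇ_; _≤ᵇ_; _<_; _≤_; s≤s; _⊓_; _∸_)
import Data.Nat.Properties as ℕP
open import Data.Nat.Solver using (module +-*-Solver)
open +-*-Solver using (solve; _:+_; _:=_)
import Data.Integer as Int
open Int using (ℤ)
import Data.Integer.Properties as IntP
open import Data.Fin as Fin using (Fin; toℕ)
import Data.Fin.Properties as FinP
open import Data.List using (List; []; _∷_; _++_; length; map; filterᵇ)
import Data.List.Properties as ListP
open import Data.List.Relation.Binary.Permutation.Propositional as ↭
  using (_↭_; prep; swap)
open import Data.List.Relation.Binary.Permutation.Propositional.Properties
  using (↭-length; filter-↭)
open import Data.Vec using (Vec; []; _∷_; toList)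
import Data.Vec.Properties as VecP
open import Data.Product using (Σ; _×_; _,_; proj₁; proj₂)
open import Data.Sum using (inj₁; inj₂)
open import Function.Bundles using (Equivalence)
open import Relation.Nullary using (¬_; yes; no; Dec)
open import Relation.Binary.PropositionalEquality
open import Relation.Binary.Definitions using (tri<; tri≈; tri>)

module Booleans where

  ∧-intro : ∀ {a b} → T a → T b → T (a ∧ b)
  ∧-intro ta tb = Equivalence.from T-∧ (ta , tb)

  ∧-fst : ∀ {a b} → T (a ∧ b) → T a
  ∧-fst t = proj₁ (Equivalence.to T-∧ t)

  ∧-snd : ∀ {a b} → T (a ∧ b) → T b
  ∧-snd t = proj₂ (Equivalence.to T-∧ t)

  T→≡ : ∀ {b} → T b → b ≡ true
  T→≡ = Equivalence.to T-≡

  ≡→T : ∀ {b} → b ≡ true → T b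
  ≡→T = Equivalence.from T-≡

  ¬T→≡ : ∀ {b} → ¬ T b → b ≡ false
  ¬T→≡ {true}  f = ⊥-elim (f tt)
  ¬T→≡ {false} f = refl

  not-intro : ∀ {b} → ¬ T b → T (not b)
  not-intro {true}  f = f tt
  not-intro {false} f = tt

  not-elim : ∀ {b} → T (not b) → ¬ T b
  not-elim {true} () _

  T-ext : ∀ {a b} → (T a → T b) → (T b → T a) → a ≡ b
  T-ext {true}  {true}  f g = refl
  T-ext {true}  {false} f g = ⊥-elim (f tt)
  T-ext {false} {true}  f g = ⊥-elim (g tt)
  T-ext {false} {false} f g = refl

  ∨-inl : ∀ {a b} → T a → T (a ∨ b)
  ∨-inl {true} t = tt

  ∨-inr : ∀ a {b} → T b → T (a ∨ b)
  ∨-inr true  t = tt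
  ∨-inr false t = t

  not-∨ : ∀ a b → not (a ∨ b) ≡ not a ∧ not b
  not-∨ true  b = refl
  not-∨ false b = refl

  module ∧-Solver = CMSolver ∧-commutativeMonoid
  module ∨-Solver = CMSolver ∨-commutativeMonoid

open Booleans

module Comparisons where

  lt : ∀ {k} → Fin k → Fin k → Bool
  lt x y = toℕ x <ᵇ toℕ y

  lt⇒< : ∀ {k} (x y : Fin k) → T (lt x y) → toℕ x < toℕ y
  lt⇒< x y = ℕP.<ᵇ⇒< (toℕ x) (toℕ y)

  <⇒lt : ∀ {k} (x y : Fin k) → toℕ x < toℕ y → T (lt x y)
  <⇒lt x y = ℕP.<⇒<ᵇ

  lt-trans : ∀ {k} (x y z : Fin k) → T (lt x y) → T (lt y z) → T (lt x z)
  lt-trans x y z p q = <⇒lt x z (ℕP.<-trans (lt⇒< x y p) (lt⇒< y z q))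

  lt-asym : ∀ {k} (x y : Fin k) → T (lt x y) → ¬ T (lt y x)
  lt-asym x y p q = ℕP.<-asym (lt⇒< x y p) (lt⇒< y x q)

  ==⇒≡ : ∀ {x y} → T (x == y) → x ≡ y
  ==⇒≡ {x} {y} t = ℕP.≤-antisym (ℕP.≤ᵇ⇒≤ x y (∧-fst t)) (ℕP.≤ᵇ⇒≤ y x (∧-snd t))

  ≡⇒== : ∀ {x y} → x ≡ y → T (x == y)
  ≡⇒== {x} refl = ∧-intro (ℕP.≤⇒≤ᵇ (ℕP.≤-refl {x})) (ℕP.≤⇒≤ᵇ (ℕP.≤-refl {x}))

  ==-sym : ∀ x y → (x == y) ≡ (y == x)
  ==-sym x y = T-ext (λ t → ≡⇒== (sym (==⇒≡ {x} {y} t))) (λ t → ≡⇒== (sym (==⇒≡ {y} {x} t)))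

  <⇒==-false : ∀ {x y} → x < y → (x == y) ≡ false
  <⇒==-false {x} {y} x<y = ¬T→≡ (λ t → ℕP.<-irrefl (==⇒≡ {x} {y} t) x<y)

  ≤ᵇ≡not<ᵇ : ∀ m x → (m ≤ᵇ x) ≡ not (x <ᵇ m)
  ≤ᵇ≡not<ᵇ m x = T-ext
    (λ t → not-intro (λ u → ℕP.<⇒≱ (ℕP.<ᵇ⇒< x m u) (ℕP.≤ᵇ⇒≤ m x t)))
    (λ t → ℕP.≤⇒≤ᵇ {m} {x} (ℕP.≮⇒≥ (λ u → not-elim t (ℕP.<⇒<ᵇ u))))

open Comparisons

module Lists {A : Set} where

  all-mono : ∀ {p q : A → Bool} → (∀ x → T (p x) → T (q x)) → ∀ l → T (all p l) → T (all q l)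
  all-mono f []      t = tt
  all-mono f (x ∷ l) t = ∧-intro (f x (∧-fst t)) (all-mono f l (∧-snd t))

  all-∧ : ∀ {p q : A → Bool} l → T (all p l) → T (all q l) → T (all (λ x → p x ∧ q x) l)
  all-∧ []      s t = tt
  all-∧ {p} {q} (x ∷ l) s t =
    ∧-intro (∧-intro (∧-fst {p x} s) (∧-fst {q x} t)) (all-∧ l (∧-snd {p x} s) (∧-snd {q x} t))

  all-++ : ∀ (p : A → Bool) l₁ l₂ → all p (l₁ ++ l₂) ≡ all p l₁ ∧ all p l₂
  all-++ p []       l₂ = refl
  all-++ p (x ∷ l₁) l₂ = trans (cong (p x ∧_) (all-++ p l₁ l₂)) (sym (∧-assoc (p x) _ _))

  all-↭ : ∀ (p : A → Bool) {l l'} → l ↭ l' → all p l ≡ all p l'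
  all-↭ p ↭.refl               = refl
  all-↭ p (prep x l↭l')        = cong (p x ∧_) (all-↭ p l↭l')
  all-↭ p (swap {xs} x y l↭l') =
    trans (∧-Solver.solve 3 (λ a b c → a ⊕ (b ⊕ c) ⊜ b ⊕ (a ⊕ c)) refl (p x) (p y) (all p xs))
          (cong (λ z → p y ∧ (p x ∧ z)) (all-↭ p l↭l'))
    where open ∧-Solver using (_⊕_; _⊜_)
  all-↭ p (↭.trans l↭l' l'↭l'') = trans (all-↭ p l↭l') (all-↭ p l'↭l'')

  all-swap : ∀ {B : Set} (f : A → B → Bool) l₁ l₂ →
             all (λ x → all (f x) l₂) l₁ ≡ all (λ y → all (λ x → f x y) l₁) l₂
  all-swap f []       l₂ = sym (T→≡ (all-true l₂))
    where
    all-true : ∀ l → T (all (λ _ → true) l)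
    all-true []      = tt
    all-true (_ ∷ l) = all-true l
  all-swap f (x ∷ l₁) l₂ = trans (cong (all (f x) l₂ ∧_) (all-swap f l₁ l₂)) (sym (all-∧≡ l₂))
    where
    all-∧≡ : ∀ l → all (λ y → f x y ∧ all (λ x → f x y) l₁) l ≡ all (f x) l ∧ all (λ y → all (λ x → f x y) l₁) l
    all-∧≡ []      = refl
    all-∧≡ (y ∷ l) rewrite all-∧≡ l =
      ∧-Solver.solve 4 (λ a b c d → (a ⊕ b) ⊕ (c ⊕ d) ⊜ (a ⊕ c) ⊕ (b ⊕ d)) refl
        (f x y) (all (λ x → f x y) l₁) (all (f x) l) (all (λ y → all (λ x → f x y) l₁) l)
      where open ∧-Solver using (_⊕_; _⊜_)

  all-map : ∀ {B : Set} (p : B → Bool) (f : A → B) l → all p (map f l) ≡ all (λ x → p (f x)) l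
  all-map p f []      = refl
  all-map p f (x ∷ l) = cong (p (f x) ∧_) (all-map p f l)

  all-filter : ∀ {p : A → Bool} (q : A → Bool) l → T (all p l) → T (all p (filterᵇ q l))
  all-filter q []      t = tt
  all-filter q (x ∷ l) t with q x
  ... | true  = ∧-intro (∧-fst t) (all-filter q l (∧-snd t))
  ... | false = all-filter q l (∧-snd t)

  all-filter-self : ∀ (p : A → Bool) l → T (all p (filterᵇ p l))
  all-filter-self p []      = tt
  all-filter-self p (x ∷ l) with p x in eq
  ... | true  = ∧-intro (≡→T eq) (all-filter-self p l)
  ... | false = all-filter-self p l

  filter-all : ∀ (p : A → Bool) l → T (all p l) → filterᵇ p l ≡ l
  filter-all p []      t = refl
  filter-all p (x ∷ l) t with p x | t
  ... | true | t' = cong (x ∷_) (filter-all p l t')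

  filter-none : ∀ (p : A → Bool) l → T (all (λ x → not (p x)) l) → filterᵇ p l ≡ []
  filter-none p []      t = refl
  filter-none p (x ∷ l) t with p x | t
  ... | false | t' = filter-none p l t'

  length-filter-split : ∀ (p : A → Bool) l →
    length (filterᵇ p l) + length (filterᵇ (λ x → not (p x)) l) ≡ length l
  length-filter-split p []      = refl
  length-filter-split p (x ∷ l) with p x
  ... | true  = cong suc (length-filter-split p l)
  ... | false = trans (ℕP.+-suc _ _) (cong suc (length-filter-split p l))

  length-filter-all : ∀ (p : A → Bool) l → T (all p l) → length (filterᵇ p l) ≡ length l
  length-filter-all p l t = cong length (filter-all p l t)

  length-filter-0 : ∀ (p : A → Bool) l → length (filterᵇ p l) ≡ 0 → T (all (λ x → not (p x)) l)
  length-filter-0 p []      e = tt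
  length-filter-0 p (x ∷ l) e with p x
  ... | false = ∧-intro {a = true} tt (length-filter-0 p l e)

open Lists

module Vectors {A : Set} where

  toList-injective : ∀ {k} {xs ys : Vec A k} → toList xs ≡ toList ys → xs ≡ ys
  toList-injective {xs = xs} {ys} h = trans (sym (VecP.cast-is-id refl xs)) (VecP.toList-injective refl xs ys h)

  allV-toList : ∀ {k} (p : A → Bool) (v : Vec A k) → allV p v ≡ all p (toList v)
  allV-toList p []      = refl
  allV-toList p (x ∷ v) = cong (p x ∧_) (allV-toList p v)

  fromListPad : ∀ k → A → List A → Vec A k
  fromListPad zero    d l       = []
  fromListPad (suc k) d []      = d ∷ fromListPad k d []
  fromListPad (suc k) d (x ∷ l) = x ∷ fromListPad k d l

  fromListPad-toList : ∀ {k} d (v : Vec A k) → fromListPad k d (toList v) ≡ v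
  fromListPad-toList d []      = refl
  fromListPad-toList d (x ∷ v) = cong (x ∷_) (fromListPad-toList d v)

  toList-fromListPad : ∀ k d (l : List A) → length l ≡ k → toList (fromListPad k d l) ≡ l
  toList-fromListPad zero    d []      e = refl
  toList-fromListPad (suc k) d (x ∷ l) e = cong (x ∷_) (toList-fromListPad k d l (ℕP.suc-injective e))

open Vectors

-- A
-- face is stored as its increasing list of vertices, so faces of the form
-- S ∪ ρ arise by inserting the vertices of S into ρ one at a time.
module Sorted {k : ℕ} where

  Vertex : Set
  Vertex = Fin k

  increasing : List Vertex → Bool
  increasing []          = true
  increasing (x ∷ [])    = true
  increasing (x ∷ y ∷ l) = lt x y ∧ increasing (y ∷ l)

  sorted : List Vertex → Bool
  sorted []      = true
  sorted (x ∷ l) = all (lt x) l ∧ sorted l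

  increasing-toList : ∀ {j} (v : Vec Vertex j) → incr v ≡ increasing (toList v)
  increasing-toList []          = refl
  increasing-toList (x ∷ [])    = refl
  increasing-toList (x ∷ y ∷ v) = cong (lt x y ∧_) (increasing-toList (y ∷ v))

  increasing≡sorted : ∀ l → increasing l ≡ sorted l
  increasing≡sorted l = T-ext (to l) (from l)
    where
    to : ∀ l → T (increasing l) → T (sorted l)
    to []          t = tt
    to (x ∷ [])    t = ∧-intro tt tt
    to (x ∷ y ∷ l) t =
      let xy = ∧-fst t ; s = to (y ∷ l) (∧-snd t) in
      ∧-intro (∧-intro xy (all-mono (λ z → lt-trans x y z xy) l (∧-fst {all (lt y) l} s))) s
    from : ∀ l → T (sorted l) → T (increasing l)
    from []          t = tt
    from (x ∷ [])    t = tt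
    from (x ∷ y ∷ l) t = ∧-intro (∧-fst {lt x y} (∧-fst t)) (from (y ∷ l) (∧-snd {all (lt x) (y ∷ l)} t))

  tail-increasing : ∀ {j} {x} (v : Vec Vertex j) → T (incr (x ∷ v)) → T (incr v)
  tail-increasing []      t = tt
  tail-increasing (y ∷ v) t = ∧-snd t

  sorted-filter : ∀ (p : Vertex → Bool) l → T (sorted l) → T (sorted (filterᵇ p l))
  sorted-filter p []      t = tt
  sorted-filter p (x ∷ l) t with p x
  ... | true  = ∧-intro (all-filter p l (∧-fst t)) (sorted-filter p l (∧-snd {all (lt x) l} t))
  ... | false = sorted-filter p l (∧-snd {all (lt x) l} t)

  insert : Vertex → List Vertex → List Vertex
  insert v []      = v ∷ []
  insert v (x ∷ l) = if lt x v then x ∷ insert v l else v ∷ x ∷ l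

  toList-ins : ∀ {c ℓ} (R : Ring c ℓ) {j} v (σ : Vec Vertex j) → toList (ins R v σ) ≡ insert v (toList σ)
  toList-ins R v []      = refl
  toList-ins R v (x ∷ σ) with lt x v
  ... | true  = cong (x ∷_) (toList-ins R v σ)
  ... | false = refl

  insert-↭ : ∀ v l → insert v l ↭ v ∷ l
  insert-↭ v []      = ↭.refl
  insert-↭ v (x ∷ l) with lt x v
  ... | true  = ↭.trans (prep x (insert-↭ v l)) (swap x v ↭.refl)
  ... | false = ↭.refl

  insert-past : ∀ {v x} l → T (lt x v) → insert v (x ∷ l) ≡ x ∷ insert v l
  insert-past l t rewrite T→≡ t = refl

  insert-here : ∀ {v x} l → ¬ T (lt x v) → insert v (x ∷ l) ≡ v ∷ x ∷ l
  insert-here l t rewrite ¬T→≡ t = refl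

  insert-front : ∀ v l → T (all (lt v) l) → insert v l ≡ v ∷ l
  insert-front v []      t = refl
  insert-front v (x ∷ l) t = insert-here l (lt-asym v x (∧-fst t))

  sorted-insert⁻ : ∀ v l → T (sorted (insert v l)) → T (sorted l)
  sorted-insert⁻ v []      t = tt
  sorted-insert⁻ v (x ∷ l) t with lt x v
  ... | true  = ∧-intro (∧-snd {lt x v} (≡→T (trans (sym (all-↭ (lt x) (insert-↭ v l))) (T→≡ (∧-fst t)))))
                        (sorted-insert⁻ v l (∧-snd {all (lt x) (insert v l)} t))
  ... | false = ∧-snd {all (lt v) (x ∷ l)} t

  distinctFrom : Vertex → Vertex → Bool
  distinctFrom v x = not (toℕ x == toℕ v)

  sorted-insert⁺ : ∀ v l → T (sorted l) → T (all (distinctFrom v) l) → T (sorted (insert v l))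
  sorted-insert⁺ v []      t d = ∧-intro tt tt
  sorted-insert⁺ v (x ∷ l) t d with lt x v in eq
  ... | true  = ∧-intro (≡→T (trans (all-↭ (lt x) (insert-↭ v l)) (T→≡ (∧-intro (≡→T eq) (∧-fst t)))))
                        (sorted-insert⁺ v l (∧-snd {all (lt x) l} t) (∧-snd d))
  ... | false = ∧-intro (∧-intro v<x (all-mono (λ z → lt-trans v x z v<x) l (∧-fst t))) t
    where
    v<x : T (lt v x)
    v<x = <⇒lt v x (ℕP.≤∧≢⇒< (ℕP.≮⇒≥ (λ x<v → subst T eq (<⇒lt x v x<v)))
                              (λ v≡x → not-elim (∧-fst d) (≡⇒== (sym v≡x))))

  private
    insert-swap-front : ∀ v w t → insert v t ≡ v ∷ t → insert w t ≡ w ∷ t →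
                        insert v (w ∷ t) ≡ insert w (v ∷ t)
    insert-swap-front v w t hv hw with ℕP.<-cmp (toℕ v) (toℕ w)
    ... | tri< v<w _ _ = trans (insert-here t (lt-asym v w (<⇒lt v w v<w)))
                               (sym (trans (insert-past t (<⇒lt v w v<w)) (cong (v ∷_) hw)))
    ... | tri≈ _ v≡w _ rewrite FinP.toℕ-injective v≡w = refl
    ... | tri> _ _ w<v = trans (insert-past t (<⇒lt w v w<v))
                               (trans (cong (w ∷_) hv) (sym (insert-here t (lt-asym w v (<⇒lt w v w<v)))))

    insert-pass-stop : ∀ v w x l → T (lt x v) → ¬ T (lt x w) →
                       insert v (insert w (x ∷ l)) ≡ insert w (insert v (x ∷ l))
    insert-pass-stop v w x l x<v x≮w = begin
      insert v (insert w (x ∷ l)) ≡⟨ cong (insert v) (insert-here l x≮w) ⟩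
      insert v (w ∷ x ∷ l)        ≡⟨ insert-past (x ∷ l) w<v ⟩
      w ∷ insert v (x ∷ l)        ≡⟨ cong (w ∷_) (insert-past l x<v) ⟩
      w ∷ x ∷ insert v l          ≡⟨ sym (insert-here (insert v l) x≮w) ⟩
      insert w (x ∷ insert v l)   ≡⟨ cong (insert w) (sym (insert-past l x<v)) ⟩
      insert w (insert v (x ∷ l)) ∎
      where
      open ≡-Reasoning
      w<v : T (lt w v)
      w<v = <⇒lt w v (ℕP.≤-<-trans (ℕP.≮⇒≥ (λ x<w → x≮w (<⇒lt x w x<w))) (lt⇒< x v x<v))

  insert-comm : ∀ v w l → insert v (insert w l) ≡ insert w (insert v l)
  insert-comm v w []      = insert-swap-front v w [] refl refl
  insert-comm v w (x ∷ l) with T? (lt x v) | T? (lt x w)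
  ... | yes x<v | yes x<w = begin
    insert v (insert w (x ∷ l)) ≡⟨ cong (insert v) (insert-past l x<w) ⟩
    insert v (x ∷ insert w l)   ≡⟨ insert-past (insert w l) x<v ⟩
    x ∷ insert v (insert w l)   ≡⟨ cong (x ∷_) (insert-comm v w l) ⟩
    x ∷ insert w (insert v l)   ≡⟨ sym (insert-past (insert v l) x<w) ⟩
    insert w (x ∷ insert v l)   ≡⟨ cong (insert w) (sym (insert-past l x<v)) ⟩
    insert w (insert v (x ∷ l)) ∎
    where open ≡-Reasoning
  ... | yes x<v | no x≮w  = insert-pass-stop v w x l x<v x≮w
  ... | no x≮v  | yes x<w = sym (insert-pass-stop w v x l x<w x≮v)
  ... | no x≮v  | no x≮w  = begin
    insert v (insert w (x ∷ l)) ≡⟨ cong (insert v) (insert-here l x≮w) ⟩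
    insert v (w ∷ x ∷ l)        ≡⟨ insert-swap-front v w (x ∷ l) (insert-here l x≮v) (insert-here l x≮w) ⟩
    insert w (v ∷ x ∷ l)        ≡⟨ cong (insert w) (sym (insert-here l x≮v)) ⟩
    insert w (insert v (x ∷ l)) ∎
    where open ≡-Reasoning

  insertAll : List Vertex → List Vertex → List Vertex
  insertAll []      ρ = ρ
  insertAll (s ∷ S) ρ = insert s (insertAll S ρ)

  insertAll-↭ : ∀ S ρ → insertAll S ρ ↭ S ++ ρ
  insertAll-↭ []      ρ = ↭.refl
  insertAll-↭ (s ∷ S) ρ = ↭.trans (insert-↭ s (insertAll S ρ)) (prep s (insertAll-↭ S ρ))

  insertAll-insert : ∀ S v ρ → insertAll S (insert v ρ) ≡ insert v (insertAll S ρ)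
  insertAll-insert []      v ρ = refl
  insertAll-insert (s ∷ S) v ρ = trans (cong (insert s) (insertAll-insert S v ρ)) (insert-comm s v (insertAll S ρ))

  insertAll-front : ∀ S x ρ → T (all (lt x) S) → insertAll S (x ∷ ρ) ≡ x ∷ insertAll S ρ
  insertAll-front []      x ρ t = refl
  insertAll-front (s ∷ S) x ρ t =
    trans (cong (insert s) (insertAll-front S x ρ (∧-snd {lt x s} t))) (insert-past (insertAll S ρ) (∧-fst t))

  sorted-insertAll⁻ : ∀ S ρ → T (sorted (insertAll S ρ)) → T (sorted ρ)
  sorted-insertAll⁻ []      ρ t = t
  sorted-insertAll⁻ (s ∷ S) ρ t = sorted-insertAll⁻ S ρ (sorted-insert⁻ s (insertAll S ρ) t)

  sorted-insertAll⁺ : ∀ S ρ → T (sorted S) → T (sorted ρ) →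
                      T (all (λ s → all (distinctFrom s) ρ) S) → T (sorted (insertAll S ρ))
  sorted-insertAll⁺ []      ρ s t d = t
  sorted-insertAll⁺ (x ∷ S) ρ s t d =
    sorted-insert⁺ x (insertAll S ρ) (sorted-insertAll⁺ S ρ (∧-snd {all (lt x) S} s) t (∧-snd {all (distinctFrom x) ρ} d))
      (≡→T (trans (all-↭ (distinctFrom x) (insertAll-↭ S ρ)) (trans (all-++ (distinctFrom x) S ρ)
        (T→≡ (∧-intro (all-mono (λ y x<y → not-intro (λ y≡x → ℕP.<-irrefl (sym (==⇒≡ y≡x)) (lt⇒< x y x<y))) S (∧-fst s))
                      (∧-fst d))))))

  merge-filter : ∀ (p : Vertex → Bool) l → T (sorted l) →
                 insertAll (filterᵇ p l) (filterᵇ (λ y → not (p y)) l) ≡ l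
  merge-filter p []      t = refl
  merge-filter p (x ∷ l) t with p x
  ... | true  = trans (cong (insert x) (merge-filter p l (∧-snd {all (lt x) l} t))) (insert-front x l (∧-fst t))
  ... | false = trans (insertAll-front (filterᵇ p l) x _ (all-filter p l (∧-fst t)))
                      (cong (x ∷_) (merge-filter p l (∧-snd {all (lt x) l} t)))

  private
    filter-insert-reject : ∀ (q : Vertex → Bool) v l → ¬ T (q v) → filterᵇ q (insert v l) ≡ filterᵇ q l
    filter-insert-reject q v []      f rewrite ¬T→≡ f = refl
    filter-insert-reject q v (x ∷ l) f with lt x v
    ... | false rewrite ¬T→≡ f = refl
    ... | true with q x
    ...   | true  = cong (x ∷_) (filter-insert-reject q v l f)
    ...   | false = filter-insert-reject q v l f

    filter-insert-accept : ∀ (p : Vertex → Bool) v l → T (p v) → T (all (λ y → not (p y ∧ lt y v)) l) →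
                           filterᵇ p (insert v l) ≡ v ∷ filterᵇ p l
    filter-insert-accept p v []      t a rewrite T→≡ t = refl
    filter-insert-accept p v (x ∷ l) t a with lt x v
    ... | false rewrite T→≡ t = refl
    ... | true with p x
    ...   | true  = ⊥-elim a
    ...   | false = filter-insert-accept p v l t a

  filter-insertAll-reject : ∀ (p : Vertex → Bool) S ρ → T (all p S) → T (all (λ y → not (p y)) ρ) →
                            filterᵇ (λ y → not (p y)) (insertAll S ρ) ≡ ρ
  filter-insertAll-reject p []      ρ a b = filter-all _ ρ b
  filter-insertAll-reject p (s ∷ S) ρ a b =
    trans (filter-insert-reject _ s (insertAll S ρ) (λ u → not-elim u (∧-fst a)))
          (filter-insertAll-reject p S ρ (∧-snd {p s} a) b)

  filter-insertAll-accept : ∀ (p : Vertex → Bool) S ρ → T (sorted S) → T (all p S) → T (all (λ y → not (p y)) ρ) →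
                            filterᵇ p (insertAll S ρ) ≡ S
  filter-insertAll-accept p []      ρ s a b = filter-none p ρ b
  filter-insertAll-accept p (x ∷ S) ρ s a b =
    trans (filter-insert-accept p x (insertAll S ρ) (∧-fst a) none-before)
          (cong (x ∷_) (filter-insertAll-accept p S ρ (∧-snd {all (lt x) S} s) (∧-snd {p x} a) b))
    where
    none-before : T (all (λ y → not (p y ∧ lt y x)) (insertAll S ρ))
    none-before = ≡→T (trans (all-↭ _ (insertAll-↭ S ρ)) (trans (all-++ _ S ρ) (T→≡ (∧-intro
      (all-mono (λ y x<y → not-intro (λ u → lt-asym x y x<y (∧-snd u))) S (∧-fst s))
      (all-mono (λ y ¬py → not-intro (λ u → not-elim ¬py (∧-fst u))) ρ b)))))

  count : (Vertex → Bool) → List Vertex → ℕ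
  count p l = length (filterᵇ p l)

  indicator : Bool → ℕ
  indicator b = if b then 1 else 0

  count-cons : ∀ (p : Vertex → Bool) x l → count p (x ∷ l) ≡ indicator (p x) + count p l
  count-cons p x l with p x
  ... | true  = refl
  ... | false = refl

  count-↭ : ∀ (p : Vertex → Bool) {l l'} → l ↭ l' → count p l ≡ count p l'
  count-↭ p l↭l' = ↭-length (filter-↭ (λ y → T? (p y)) l↭l')

  count-++ : ∀ (p : Vertex → Bool) l l' → count p (l ++ l') ≡ count p l + count p l'
  count-++ p l l' = trans (cong length (ListP.filter-++ (λ y → T? (p y)) l l')) (ListP.length-++ (filterᵇ p l))

  count-insertAll : ∀ (p : Vertex → Bool) S ρ → count p (insertAll S ρ) ≡ count p S + count p ρ
  count-insertAll p S ρ = trans (count-↭ p (insertAll-↭ S ρ)) (count-++ p S ρ)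

  -- the number of entries in front of the insertion point of v; for a sorted
  -- face this is the position of v, which governs the sign of the face map
  position : Vertex → List Vertex → ℕ
  position v []      = 0
  position v (x ∷ l) = if lt x v then suc (position v l) else 0

  position-toList : ∀ {c ℓ} (R : Ring c ℓ) {j} v (σ : Vec Vertex j) → below R v σ ≡ position v (toList σ)
  position-toList R v []      = refl
  position-toList R v (x ∷ σ) with lt x v
  ... | true  = cong suc (position-toList R v σ)
  ... | false = refl

  position-insert : ∀ v w l → position v (insert w l) ≡ indicator (lt w v) + position v l
  position-insert v w []      with lt w v
  ... | true  = refl
  ... | false = refl
  position-insert v w (x ∷ l) with T? (lt x w) | T? (lt x v)
  ... | yes x<w | yes x<v rewrite insert-past {w} l x<w | T→≡ x<v =
    trans (cong suc (position-insert v w l)) (sym (ℕP.+-suc (indicator (lt w v)) (position v l)))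
  ... | yes x<w | no x≮v rewrite insert-past {w} l x<w | ¬T→≡ x≮v | ¬T→≡ (λ w<v → x≮v (lt-trans x w v x<w w<v)) = refl
  ... | no x≮w | _ rewrite insert-here {w} l x≮w with T? (lt w v)
  ...   | yes w<v rewrite T→≡ w<v = refl
  ...   | no w≮v rewrite ¬T→≡ w≮v
                       | ¬T→≡ {lt x v} (λ x<v → w≮v (<⇒lt w v (ℕP.≤-<-trans (ℕP.≮⇒≥ (λ x<w → x≮w (<⇒lt x w x<w)))
                                                                             (lt⇒< x v x<v)))) = refl

  position-insertAll : ∀ v S ρ → position v (insertAll S ρ) ≡ count (λ s → lt s v) S + position v ρ
  position-insertAll v []      ρ = refl
  position-insertAll v (s ∷ S) ρ = begin
    position v (insert s (insertAll S ρ))                                ≡⟨ position-insert v s (insertAll S ρ) ⟩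
    indicator (lt s v) + position v (insertAll S ρ)                      ≡⟨ cong (indicator (lt s v) +_) (position-insertAll v S ρ) ⟩
    indicator (lt s v) + (count (λ s → lt s v) S + position v ρ)         ≡⟨ sym (ℕP.+-assoc (indicator (lt s v)) _ _) ⟩
    (indicator (lt s v) + count (λ s → lt s v) S) + position v ρ         ≡⟨ cong (_+ position v ρ) (sym (count-cons (λ s → lt s v) s S)) ⟩
    count (λ s → lt s v) (s ∷ S) + position v ρ                           ∎
    where open ≡-Reasoning

  interleaving : List Vertex → List Vertex → ℕ
  interleaving []      ρ = 0
  interleaving (s ∷ S) ρ = count (lt s) ρ + interleaving S ρ

  interleaving-insert : ∀ S v ρ → interleaving S (insert v ρ) ≡ count (λ s → lt s v) S + interleaving S ρ
  interleaving-insert []      v ρ = refl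
  interleaving-insert (s ∷ S) v ρ = begin
    count (lt s) (insert v ρ) + interleaving S (insert v ρ)
      ≡⟨ cong₂ _+_ (trans (count-↭ (lt s) (insert-↭ v ρ)) (count-cons (lt s) v ρ)) (interleaving-insert S v ρ) ⟩
    (indicator (lt s v) + count (lt s) ρ) + (count (λ s → lt s v) S + interleaving S ρ)
      ≡⟨ solve 4 (λ a b c d → (a :+ b) :+ (c :+ d) := (a :+ c) :+ (b :+ d)) refl
                          (indicator (lt s v)) (count (lt s) ρ) (count (λ s → lt s v) S) (interleaving S ρ) ⟩
    (indicator (lt s v) + count (λ s → lt s v) S) + (count (lt s) ρ + interleaving S ρ)
      ≡⟨ cong (_+ _) (sym (count-cons (λ s → lt s v) s S)) ⟩
    count (λ s → lt s v) (s ∷ S) + (count (lt s) ρ + interleaving S ρ) ∎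
    where open ≡-Reasoning

  -- The sign rule behind the face maps: removing v from ρ and removing v
  -- from the merge S ∪ ρ differ by the change in interleaving of S with ρ.
  position-interleaving : ∀ S v ρ →
    position v ρ + interleaving S (insert v ρ) ≡ interleaving S ρ + position v (insertAll S ρ)
  position-interleaving S v ρ
    rewrite interleaving-insert S v ρ | position-insertAll v S ρ =
    solve 3 (λ a b c → a :+ (b :+ c) := c :+ (b :+ a)) refl
      (position v ρ) (count (λ s → lt s v) S) (interleaving S ρ)

module Chains {c ℓ : Level} (R : Ring c ℓ) where
  open Ring R renaming (_+_ to _+R_; refl to ≈-refl; sym to ≈-sym; trans to ≈-trans; setoid to ≈-setoid)
  open import Algebra.Properties.Ring R using (-‿distribˡ-*; -‿distribʳ-*; -‿involutive; x[y-z]≈xy-xz)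
  import Algebra.Properties.Monoid.Sum +-monoid as MonoidSum
  import Algebra.Properties.CommutativeMonoid.Sum +-commutativeMonoid as CommutativeMonoidSum
  import Algebra.Properties.Semiring.Sum semiring as SemiringSum
  open import Relation.Binary.Reasoning.Setoid ≈-setoid

  sg : ℕ → Carrier
  sg = sgn R

  sg-+ : ∀ a b x → sg (a + b) * x ≈ sg a * (sg b * x)
  sg-+ zero    b x = ≈-sym (*-identityˡ _)
  sg-+ (suc a) b x = begin
    (- sg (a + b)) * x    ≈⟨ ≈-sym (-‿distribˡ-* _ _) ⟩
    - (sg (a + b) * x)    ≈⟨ -‿cong (sg-+ a b x) ⟩
    - (sg a * (sg b * x)) ≈⟨ -‿distribˡ-* _ _ ⟩
    (- sg a) * (sg b * x) ∎

  sg-twice : ∀ a x → sg a * (sg a * x) ≈ x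
  sg-twice a x = begin
    sg a * (sg a * x) ≈⟨ ≈-sym (sg-+ a a x) ⟩
    sg (a + a) * x    ≈⟨ *-congʳ (even a) ⟩
    1# * x            ≈⟨ *-identityˡ x ⟩
    x                 ∎
    where
    even : ∀ a → sg (a + a) ≈ 1#
    even zero    = ≈-refl
    even (suc a) = begin
      - sg (a + suc a)   ≡⟨ cong (λ z → - sg z) (ℕP.+-suc a a) ⟩
      - - sg (a + a)     ≈⟨ -‿involutive _ ⟩
      sg (a + a)         ≈⟨ even a ⟩
      1#                 ∎

  sg-comm : ∀ r b x → r * (sg b * x) ≈ sg b * (r * x)
  sg-comm r zero    x = ≈-trans (*-congˡ (*-identityˡ x)) (≈-sym (*-identityˡ _))
  sg-comm r (suc b) x = begin
    r * ((- sg b) * x)   ≈⟨ *-congˡ (≈-sym (-‿distribˡ-* _ _)) ⟩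
    r * (- (sg b * x))   ≈⟨ ≈-sym (-‿distribʳ-* _ _) ⟩
    - (r * (sg b * x))   ≈⟨ -‿cong (sg-comm r b x) ⟩
    - (sg b * (r * x))   ≈⟨ -‿distribˡ-* _ _ ⟩
    (- sg b) * (r * x)   ∎

  if-zero-cong : ∀ {b₁ b₂} → b₁ ≡ b₂ → ∀ s {x y} → x ≈ s * y →
                 (if b₁ then x else 0#) ≈ s * (if b₂ then y else 0#)
  if-zero-cong {true}  refl s h = h
  if-zero-cong {false} refl s h = ≈-sym (zeroʳ s)

  sumFin≡sum : ∀ {N} (f : Fin N → Carrier) → sumFin R f ≡ MonoidSum.sum f
  sumFin≡sum {zero}  f = refl
  sumFin≡sum {suc N} f = cong (f Fin.zero +R_) (sumFin≡sum (λ v → f (Fin.suc v)))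

  sum-cong : ∀ {N} {f g : Fin N → Carrier} → (∀ v → f v ≈ g v) → sumFin R f ≈ sumFin R g
  sum-cong {N} {f} {g} h = begin
    sumFin R f     ≡⟨ sumFin≡sum f ⟩
    MonoidSum.sum f ≈⟨ MonoidSum.sum-cong-≋ h ⟩
    MonoidSum.sum g ≡⟨ sumFin≡sum g ⟨
    sumFin R g     ∎

  sum-scale : ∀ {N} r (f : Fin N → Carrier) → r * sumFin R f ≈ sumFin R (λ v → r * f v)
  sum-scale {N} r f = begin
    r * sumFin R f                  ≡⟨ cong (r *_) (sumFin≡sum f) ⟩
    r * MonoidSum.sum f             ≈⟨ SemiringSum.*-distribˡ-sum r f ⟩
    MonoidSum.sum (λ v → r * f v)   ≡⟨ sumFin≡sum {N} (λ v → r * f v) ⟨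
    sumFin R (λ v → r * f v)        ∎

  sum-+ : ∀ {N} (f g : Fin N → Carrier) → sumFin R (λ v → f v +R g v) ≈ sumFin R f +R sumFin R g
  sum-+ {N} f g = begin
    sumFin R (λ v → f v +R g v)               ≡⟨ sumFin≡sum {N} (λ v → f v +R g v) ⟩
    MonoidSum.sum (λ v → f v +R g v)          ≈⟨ CommutativeMonoidSum.∑-distrib-+ f g ⟩
    MonoidSum.sum f +R MonoidSum.sum g        ≡⟨ cong₂ _+R_ (sumFin≡sum f) (sumFin≡sum g) ⟨
    sumFin R f +R sumFin R g                  ∎

  sum-zero : ∀ {N} (f : Fin N → Carrier) → (∀ v → f v ≈ 0#) → sumFin R f ≈ 0#
  sum-zero {N} f h = begin
    sumFin R f                                ≈⟨ sum-cong h ⟩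
    sumFin R (λ (_ : Fin N) → 0#)             ≡⟨ sumFin≡sum {N} (λ _ → 0#) ⟩
    MonoidSum.sum (λ (_ : Fin N) → 0#)        ≈⟨ MonoidSum.sum-replicate-zero N ⟩
    0#                                        ∎

  module Boundary {N : ℕ} (Δ Γ : Family N) where
    open Rel R Δ Γ

    ∂-cong : ∀ {k} {e e' : Chain R N (suc k)} → e ≈C e' → ∀ σ → ∂ e σ ≈ ∂ e' σ
    ∂-cong {e = e} {e'} h σ = sum-cong term
      where
      term : ∀ v → (if ok (ins R v σ) then sg (below R v σ) * e (ins R v σ) else 0#)
                 ≈ (if ok (ins R v σ) then sg (below R v σ) * e' (ins R v σ) else 0#)
      term v with ok (ins R v σ) in okv
      ... | true  = *-congˡ (h (ins R v σ) (≡→T okv))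
      ... | false = ≈-refl

    ∂-zero : ∀ {k} (σ : Vec (Fin N) k) → ∂ (λ (_ : Vec (Fin N) (suc k)) → 0#) σ ≈ 0#
    ∂-zero σ = sum-zero _ term
      where
      term : ∀ v → (if ok (ins R v σ) then sg (below R v σ) * 0# else 0#) ≈ 0#
      term v with ok (ins R v σ)
      ... | true  = zeroʳ _
      ... | false = ≈-refl

    ∂-+ : ∀ {k} (e e' : Chain R N (suc k)) σ → ∂ (λ τ → e τ +R e' τ) σ ≈ ∂ e σ +R ∂ e' σ
    ∂-+ e e' σ = ≈-trans (sum-cong term) (sum-+ {N} _ _)
      where
      term : ∀ v → (if ok (ins R v σ) then sg (below R v σ) * (e (ins R v σ) +R e' (ins R v σ)) else 0#)
                 ≈ (if ok (ins R v σ) then sg (below R v σ) * e (ins R v σ) else 0#)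
                   +R (if ok (ins R v σ) then sg (below R v σ) * e' (ins R v σ) else 0#)
      term v with ok (ins R v σ)
      ... | true  = distribˡ _ _ _
      ... | false = ≈-sym (+-identityˡ 0#)

    ∂-* : ∀ {k} r (e : Chain R N (suc k)) σ → ∂ (λ τ → r * e τ) σ ≈ r * ∂ e σ
    ∂-* r e σ = ≈-trans (sum-cong term) (≈-sym (sum-scale {N} r _))
      where
      term : ∀ v → (if ok (ins R v σ) then sg (below R v σ) * (r * e (ins R v σ)) else 0#)
                 ≈ r * (if ok (ins R v σ) then sg (below R v σ) * e (ins R v σ) else 0#)
      term v with ok (ins R v σ)
      ... | true  = ≈-sym (sg-comm r (below R v σ) _)
      ... | false = ≈-sym (zeroʳ r)

    cycle-+ : ∀ k {x y : Chain R N k} → IsCycle k x → IsCycle k y → IsCycle k (λ σ → x σ +R y σ)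
    cycle-+ zero    zx zy     = zx
    cycle-+ (suc k) {x} {y} zx zy σ t = ≈-trans (∂-+ x y σ) (≈-trans (+-cong (zx σ t) (zy σ t)) (+-identityˡ 0#))

    cycle-* : ∀ k r {x : Chain R N k} → IsCycle k x → IsCycle k (λ σ → r * x σ)
    cycle-* zero    r zx     = zx
    cycle-* (suc k) r {x} zx σ t = ≈-trans (∂-* r x σ) (≈-trans (*-congˡ (zx σ t)) (zeroʳ r))

    cycle-cong : ∀ k {x y : Chain R N k} → x ≈C y → IsCycle k x → IsCycle k y
    cycle-cong zero    h z     = z
    cycle-cong (suc k) h z σ t = ≈-trans (≈-sym (∂-cong h σ)) (z σ t)

    Homologous : ∀ k → Chain R N k → Chain R N k → Set (c ⊔ ℓ)
    Homologous k x y = IsCycle k x × IsCycle k y × Σ (Chain R N (suc k)) (λ e → (λ σ → x σ - y σ) ≈C ∂ e)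

    ≈C⇒homologous : ∀ k {x y : Chain R N k} → x ≈C y → IsCycle k x → Homologous k x y
    ≈C⇒homologous k {x} {y} h z = z , cycle-cong k h z , (λ _ → 0#) ,
      λ σ t → ≈-trans (+-congʳ (h σ t)) (≈-trans (-‿inverseʳ (y σ)) (≈-sym (∂-zero σ)))

-- A face correspondence of shift i identifies the relative faces σ of
-- (Δ , Γ) of size j + i with the pairs (x , ρ) of a valid index x and a
-- relative face ρ of size j of the x-th pair, compatibly with adding a
-- vertex up to the sign (-1)^(twist x ρ).  Then the signed restriction of
-- chains is an isomorphism of chain complexes, so it induces an isomorphism
-- between the homology of (Δ , Γ) and the direct sum of the homologies of
-- the (Δₓ x , Γₓ x), shifted by i.
module Transfer {c ℓ : Level} (R : Ring c ℓ) {N : ℕ} (Δ Γ : Family N)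
  {I : Set} (Valid : I → Set) (valid? : ∀ x → Dec (Valid x)) (Δₓ Γₓ : I → Family N) (i : ℕ) where

  open Ring R using (Carrier; _≈_; _*_; _-_; 0#; *-congˡ; zeroʳ; distribˡ)
    renaming (refl to ≈-refl; sym to ≈-sym; trans to ≈-trans; setoid to ≈-setoid)
  open import Algebra.Properties.Ring R using (x[y-z]≈xy-xz)
  open import Relation.Binary.Reasoning.Setoid ≈-setoid
  open Chains R

  private
    module Big = Rel R Δ Γ
    module Small (x : I) = Rel R (Δₓ x) (Γₓ x)
    module BigB = Boundary Δ Γ
    module SmallB (x : I) = Boundary (Δₓ x) (Γₓ x)

  record FaceCorrespondence : Set where
    field
      embed : ∀ {j} → I → Vec (Fin N) j → Vec (Fin N) (j + i)
      split : ∀ {j} → Vec (Fin N) (j + i) → I × Vec (Fin N) j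
      twist : ∀ {j} → I → Vec (Fin N) j → ℕ
      ok-embed    : ∀ {j} x → Valid x → (ρ : Vec (Fin N) j) → Big.ok (embed x ρ) ≡ Small.ok x ρ
      split-embed : ∀ {j} x → Valid x → (ρ : Vec (Fin N) j) → T (Small.ok x ρ) → split (embed x ρ) ≡ (x , ρ)
      embed-split : ∀ {j} (σ : Vec (Fin N) (j + i)) → T (Big.ok σ) →
                    embed (proj₁ (split {j} σ)) (proj₂ (split {j} σ)) ≡ σ
      split-valid : ∀ {j} (σ : Vec (Fin N) (j + i)) → T (Big.ok σ) → Valid (proj₁ (split {j} σ))
      embed-ins   : ∀ {j} x → Valid x → (ρ : Vec (Fin N) j) → ∀ w → embed x (ins R w ρ) ≡ ins R w (embed x ρ)
      twist-ins   : ∀ {j} x → Valid x → (ρ : Vec (Fin N) j) → ∀ w →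
                    below R w ρ + twist x (ins R w ρ) ≡ twist x ρ + below R w (embed x ρ)
      no-small-faces : ∀ {k} (σ : Vec (Fin N) k) → k < i → ¬ T (Big.ok σ)

  module _ (no-small-faces : ∀ {k} (σ : Vec (Fin N) k) → k < i → ¬ T (Big.ok σ)) where

    small-cycle : ∀ k → k ≤ i → (x : Chain R N k) → Big.IsCycle k x
    small-cycle zero    k≤i x     = _
    small-cycle (suc k) k<i x σ t = ⊥-elim (no-small-faces σ k<i t)

    small-vanishes : ∀ K → K < i → _≅_ R (Big.Hsize K) (⨁ R I Valid (λ x → Small.trivial x))
    small-vanishes K K<i = record
      { to = λ _ _ → _ ; from = λ _ → lift (λ _ → 0#)
      ; to-cong = λ _ _ _ → _ ; from-cong = λ _ → homologous _ _
      ; from-to = λ _ → homologous _ _ ; to-from = λ _ _ _ → _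
      ; to-⊕ = λ _ _ _ _ → _ ; to-· = λ _ _ _ _ → _ }
      where
      homologous : (x y : Chain R N K) → BigB.Homologous K x y
      homologous x y = small-cycle K (ℕP.<⇒≤ K<i) x , small-cycle K (ℕP.<⇒≤ K<i) y , (λ _ → 0#) ,
                       λ σ t → ⊥-elim (no-small-faces σ K<i t)

  module _ (F : FaceCorrespondence) where
    open FaceCorrespondence F

    restrict : ∀ {j} → Chain R N (j + i) → I → Chain R N j
    restrict c x ρ = sg (twist x ρ) * c (embed x ρ)

    assemble : ∀ {j} → (I → Chain R N j) → Chain R N (j + i)
    assemble {j} g σ = let (x , ρ) = split {j} σ in sg (twist x ρ) * g x ρ

    split-ok : ∀ {j} (σ : Vec (Fin N) (j + i)) → T (Big.ok σ) →
               T (Small.ok (proj₁ (split {j} σ)) (proj₂ (split {j} σ)))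
    split-ok σ t = subst T (trans (cong Big.ok (sym (embed-split σ t))) (ok-embed _ (split-valid σ t) _)) t

    private
      face-term : ∀ {j} x → Valid x → (e : Chain R N (suc j + i)) (ρ : Vec (Fin N) j) → ∀ w →
        (if Small.ok x (ins R w ρ) then sg (below R w ρ) * restrict e x (ins R w ρ) else 0#)
        ≈ sg (twist x ρ) * (if Big.ok (ins R w (embed x ρ)) then sg (below R w (embed x ρ)) * e (ins R w (embed x ρ)) else 0#)
      face-term x v e ρ w =
        if-zero-cong (trans (sym (ok-embed x v (ins R w ρ))) (cong Big.ok (embed-ins x v ρ w))) (sg (twist x ρ)) (begin
          sg (below R w ρ) * (sg (twist x (ins R w ρ)) * e (embed x (ins R w ρ)))
                                                                 ≡⟨ cong (λ τ → _ * (_ * e τ)) (embed-ins x v ρ w) ⟩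
          sg (below R w ρ) * (sg (twist x (ins R w ρ)) * e σ′)   ≈⟨ ≈-sym (sg-+ (below R w ρ) _ _) ⟩
          sg (below R w ρ + twist x (ins R w ρ)) * e σ′          ≡⟨ cong (λ k → sg k * e σ′) (twist-ins x v ρ w) ⟩
          sg (twist x ρ + below R w (embed x ρ)) * e σ′          ≈⟨ sg-+ (twist x ρ) _ _ ⟩
          sg (twist x ρ) * (sg (below R w (embed x ρ)) * e σ′)   ∎)
        where σ′ = ins R w (embed x ρ)

    restrict-∂ : ∀ {j} x → Valid x → (e : Chain R N (suc j + i)) (ρ : Vec (Fin N) j) →
                 Small.∂ x (restrict e x) ρ ≈ restrict (Big.∂ e) x ρ
    restrict-∂ x v e ρ = ≈-trans (sum-cong (face-term x v e ρ)) (≈-sym (sum-scale {N} _ _))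

    restrict-assemble : ∀ {j} x → Valid x → (g : I → Chain R N j) (ρ : Vec (Fin N) j) →
                        T (Small.ok x ρ) → restrict (assemble g) x ρ ≈ g x ρ
    restrict-assemble x v g ρ t = begin
      sg (twist x ρ) * assemble g (embed x ρ)    ≡⟨ cong (λ p → sg (twist x ρ) * (sg (twist (proj₁ p) (proj₂ p))
                                                                                   * g (proj₁ p) (proj₂ p)))
                                                       (split-embed x v ρ t) ⟩
      sg (twist x ρ) * (sg (twist x ρ) * g x ρ)  ≈⟨ sg-twice (twist x ρ) (g x ρ) ⟩
      g x ρ                                      ∎

    assemble-restrict : ∀ {j} (c : Chain R N (j + i)) σ → T (Big.ok σ) → assemble {j} (restrict c) σ ≈ c σ
    assemble-restrict {j} c σ t =
      ≈-trans (sg-twice (twist x ρ) (c (embed x ρ))) (≈-reflexive (cong c (embed-split {j} σ t)))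
      where
      open Ring R using () renaming (reflexive to ≈-reflexive)
      x = proj₁ (split {j} σ)
      ρ = proj₂ (split {j} σ)

    assemble-∂ : ∀ {j} (g : I → Chain R N (suc j)) σ → T (Big.ok σ) →
                 Big.∂ (assemble g) σ ≈ assemble {j} (λ x → Small.∂ x (g x)) σ
    assemble-∂ {j} g σ t = begin
      Big.∂ (assemble g) σ                                   ≡⟨ cong (Big.∂ (assemble g)) (sym (embed-split σ t)) ⟩
      Big.∂ (assemble g) (embed x ρ)                         ≈⟨ sg-twice (twist x ρ) _ ⟨
      sg (twist x ρ) * restrict (Big.∂ (assemble g)) x ρ     ≈⟨ *-congˡ (restrict-∂ x v (assemble g) ρ) ⟨
      sg (twist x ρ) * Small.∂ x (restrict (assemble g) x) ρ ≈⟨ *-congˡ (SmallB.∂-cong x (restrict-assemble x v g) ρ) ⟩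
      sg (twist x ρ) * Small.∂ x (g x) ρ                     ∎
      where
      x = proj₁ (split {j} σ)
      ρ = proj₂ (split {j} σ)
      v = split-valid σ t

    restrict-cycle : ∀ {j} x → Valid x → {c : Chain R N (j + i)} → Big.IsCycle (j + i) c → Small.IsCycle x j (restrict c x)
    restrict-cycle {zero}  x v z       = _
    restrict-cycle {suc j} x v {c} z ρ t =
      ≈-trans (restrict-∂ x v c ρ) (≈-trans (*-congˡ (z (embed x ρ) (subst T (sym (ok-embed x v ρ)) t))) (zeroʳ _))

    assemble-cycle : ∀ {j} {g : I → Chain R N j} → (∀ x → Valid x → Small.IsCycle x j (g x)) →
                     Big.IsCycle (j + i) (assemble g)
    assemble-cycle {zero}  {g} z     = small-cycle no-small-faces i ℕP.≤-refl (assemble g)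
    assemble-cycle {suc j} {g} z σ t =
      ≈-trans (assemble-∂ g σ t) (≈-trans (*-congˡ (z x (split-valid {j} σ t) ρ (split-ok {j} σ t))) (zeroʳ _))
      where
      x = proj₁ (split {j} σ)
      ρ = proj₂ (split {j} σ)

    restrict-homologous : ∀ {j} x → Valid x → {c c' : Chain R N (j + i)} →
      BigB.Homologous (j + i) c c' → SmallB.Homologous x j (restrict c x) (restrict c' x)
    restrict-homologous x v {c} {c'} (z , z' , e , c-c'≈∂e) =
      restrict-cycle x v z , restrict-cycle x v z' , restrict e x , λ ρ t → begin
        sg (twist x ρ) * c (embed x ρ) - sg (twist x ρ) * c' (embed x ρ) ≈⟨ x[y-z]≈xy-xz _ _ _ ⟨
        sg (twist x ρ) * (c (embed x ρ) - c' (embed x ρ))                 ≈⟨ *-congˡ (c-c'≈∂e _ (subst T (sym (ok-embed x v ρ)) t)) ⟩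
        restrict (Big.∂ e) x ρ                                            ≈⟨ restrict-∂ x v e ρ ⟨
        Small.∂ x (restrict e x) ρ                                        ∎

    assemble-homologous : ∀ {j} {g g' : I → Chain R N j} → (∀ x → Valid x → SmallB.Homologous x j (g x) (g' x)) →
                          BigB.Homologous (j + i) (assemble g) (assemble g')
    assemble-homologous {j} {g} {g'} h =
      assemble-cycle (λ x v → proj₁ (h x v)) , assemble-cycle (λ x v → proj₁ (proj₂ (h x v))) , assemble witness ,
      λ σ t → let x = proj₁ (split {j} σ) ; ρ = proj₂ (split {j} σ) in begin
        sg (twist x ρ) * g x ρ - sg (twist x ρ) * g' x ρ ≈⟨ x[y-z]≈xy-xz _ _ _ ⟨
        sg (twist x ρ) * (g x ρ - g' x ρ)                ≈⟨ *-congˡ (witness-spec x (split-valid σ t) ρ (split-ok σ t)) ⟩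
        sg (twist x ρ) * Small.∂ x (witness x) ρ         ≈⟨ assemble-∂ witness σ t ⟨
        Big.∂ (assemble witness) σ                       ∎
      where
      witness : I → Chain R N (suc j)
      witness x with valid? x
      ... | yes v = proj₁ (proj₂ (proj₂ (h x v)))
      ... | no _  = λ _ → 0#
      witness-spec : ∀ x → Valid x → ∀ ρ → T (Small.ok x ρ) → g x ρ - g' x ρ ≈ Small.∂ x (witness x) ρ
      witness-spec x v ρ t with valid? x
      ... | yes v′ = proj₂ (proj₂ (proj₂ (h x v′))) ρ t
      ... | no ¬v  = ⊥-elim (¬v v)

    homology-≅ : ∀ j → _≅_ R (Big.Hsize (j + i)) (⨁ R I Valid (λ x → Small.Hsize x j))
    homology-≅ j = record
      { to        = λ c x → lift (restrict (lower c) x)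
      ; from      = λ g → lift (assemble (λ x → lower (g x)))
      ; to-cong   = λ h x v → restrict-homologous x v h
      ; from-cong = assemble-homologous
      ; from-to   = λ {c} h → BigB.≈C⇒homologous (j + i) (assemble-restrict (lower c))
                                (assemble-cycle (λ x v → restrict-cycle x v (proj₁ h)))
      ; to-from   = λ {g} h x v → SmallB.≈C⇒homologous x j (restrict-assemble x v (λ y → lower (g y)))
                                    (restrict-cycle x v (assemble-cycle (λ y w → proj₁ (h y w))))
      ; to-⊕      = λ hc hc' x v → SmallB.≈C⇒homologous x j (λ ρ _ → distribˡ _ _ _)
                                     (restrict-cycle x v (BigB.cycle-+ (j + i) (proj₁ hc) (proj₁ hc')))
      ; to-·      = λ r hc x v → SmallB.≈C⇒homologous x j (λ ρ _ → ≈-sym (sg-comm r (twist x ρ) _))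
                                   (restrict-cycle x v (BigB.cycle-* (j + i) r (proj₁ hc)))
      }

module Matchings (n : ℕ) where
  module SortedE = Sorted {n ℕ.* n}
  open SortedE using (distinctFrom)

  Edge : Set
  Edge = Fin (n ℕ.* n)

  end₁ end₂ : Edge → Fin n
  end₁ e = proj₁ (edge n e)
  end₂ e = proj₂ (edge n e)

  edgeOf : Fin n → Fin n → Edge
  edgeOf a b = Fin.combine a b

  end₁-edgeOf : ∀ a b → end₁ (edgeOf a b) ≡ a
  end₁-edgeOf a b = cong proj₁ (FinP.remQuot-combine a b)

  end₂-edgeOf : ∀ a b → end₂ (edgeOf a b) ≡ b
  end₂-edgeOf a b = cong proj₂ (FinP.remQuot-combine a b)

  disjoint : Edge → Edge → Bool
  disjoint e f = not (meet n e f)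

  disjoint-sym : ∀ e f → disjoint e f ≡ disjoint f e
  disjoint-sym e f = cong not (begin
    (a == a') ∨ (a == b') ∨ (b == a') ∨ (b == b')
      ≡⟨ ∨-Solver.solve 4 (λ w x y z → w ⊕ (x ⊕ (y ⊕ z)) ⊜ w ⊕ (y ⊕ (x ⊕ z))) refl
                            (a == a') (a == b') (b == a') (b == b') ⟩
    (a == a') ∨ (b == a') ∨ (a == b') ∨ (b == b')
      ≡⟨ cong₂ _∨_ (==-sym a a') (cong₂ _∨_ (==-sym b a') (cong₂ _∨_ (==-sym a b') (==-sym b b'))) ⟩
    (a' == a) ∨ (a' == b) ∨ (b' == a) ∨ (b' == b) ∎)
    where
    open ≡-Reasoning
    open ∨-Solver using (_⊕_; _⊜_)
    a = toℕ (end₁ e) ; b = toℕ (end₂ e) ; a' = toℕ (end₁ f) ; b' = toℕ (end₂ f)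

  meet-end₁ : ∀ e f → T (toℕ (end₁ e) == toℕ (end₁ f)) → T (meet n e f)
  meet-end₁ e f = ∨-inl

  meet-end₂ : ∀ e f → T (toℕ (end₂ e) == toℕ (end₂ f)) → T (meet n e f)
  meet-end₂ e f t = ∨-inr (toℕ (end₁ e) == toℕ (end₁ f)) (∨-inr (toℕ (end₁ e) == toℕ (end₂ f))
                      (∨-inr (toℕ (end₂ e) == toℕ (end₁ f)) t))

  disjoint⇒distinct : ∀ e f → T (disjoint e f) → T (distinctFrom e f)
  disjoint⇒distinct e f t = not-intro λ f≡e →
    not-elim t (subst (λ g → T (meet n e g)) (FinP.toℕ-injective (sym (==⇒≡ f≡e)))
                      (meet-end₁ e e (≡⇒== {toℕ (end₁ e)} refl)))

  allDisjoint : List Edge → List Edge → Bool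
  allDisjoint l₁ l₂ = all (λ e → all (disjoint e) l₂) l₁

  isMatching-↭ : ∀ {l l'} → l ↭ l' → isMatching n l ≡ isMatching n l'
  isMatching-↭ ↭.refl          = refl
  isMatching-↭ (prep x l↭l')   = cong₂ (λ a b → isEdge n x ∧ a ∧ b) (all-↭ (disjoint x) l↭l') (isMatching-↭ l↭l')
  isMatching-↭ (swap {xs} {ys} x y l↭l')
    rewrite disjoint-sym y x | all-↭ (disjoint x) l↭l' | all-↭ (disjoint y) l↭l' | isMatching-↭ l↭l' =
    ∧-Solver.solve 6 (λ a b c d e f → a ⊕ ((b ⊕ c) ⊕ (d ⊕ (e ⊕ f))) ⊜ d ⊕ ((b ⊕ e) ⊕ (a ⊕ (c ⊕ f)))) refl
      (isEdge n x) (disjoint x y) (all (disjoint x) ys) (isEdge n y) (all (disjoint y) ys) (isMatching n ys)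
    where open ∧-Solver using (_⊕_; _⊜_)
  isMatching-↭ (↭.trans l↭l' l'↭l'') = trans (isMatching-↭ l↭l') (isMatching-↭ l'↭l'')

  isMatching-++ : ∀ l₁ l₂ → isMatching n (l₁ ++ l₂) ≡ isMatching n l₁ ∧ (isMatching n l₂ ∧ allDisjoint l₁ l₂)
  isMatching-++ []       l₂ = sym (∧-identityʳ (isMatching n l₂))
  isMatching-++ (x ∷ l₁) l₂ rewrite all-++ (disjoint x) l₁ l₂ | isMatching-++ l₁ l₂ =
    ∧-Solver.solve 6 (λ a b c d e f → a ⊕ ((b ⊕ c) ⊕ (d ⊕ (e ⊕ f))) ⊜ (a ⊕ (b ⊕ d)) ⊕ (e ⊕ (c ⊕ f))) refl
      (isEdge n x) (all (disjoint x) l₁) (all (disjoint x) l₂) (isMatching n l₁) (isMatching n l₂) (allDisjoint l₁ l₂)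
    where open ∧-Solver using (_⊕_; _⊜_)

  isMatching-insertAll : ∀ S l → isMatching n (SortedE.insertAll S l) ≡ isMatching n S ∧ (isMatching n l ∧ allDisjoint S l)
  isMatching-insertAll S l = trans (isMatching-↭ (SortedE.insertAll-↭ S l)) (isMatching-++ S l)

  matching-edges : ∀ l → T (isMatching n l) → T (all (isEdge n) l)
  matching-edges []      t = tt
  matching-edges (x ∷ l) t = ∧-intro (∧-fst t) (matching-edges l (∧-snd {all (disjoint x) l} (∧-snd {isEdge n x} t)))

  matching-filter : ∀ (p : Edge → Bool) l → T (isMatching n l) → T (isMatching n (filterᵇ p l))
  matching-filter p []      t = tt
  matching-filter p (x ∷ l) t with p x
  ... | true  = ∧-intro {isEdge n x} (∧-fst t) (∧-intro {all (disjoint x) (filterᵇ p l)}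
                  (all-filter p l (∧-fst {all (disjoint x) l} rest)) (matching-filter p l (∧-snd {all (disjoint x) l} rest)))
    where rest = ∧-snd {isEdge n x} t
  ... | false = matching-filter p l (∧-snd {all (disjoint x) l} (∧-snd {isEdge n x} t))

-- Crossing edges: edges from [m] to [m+1,n] (in the 0-based encoding of
-- Defs, from {x < m} to {x ≥ m}).
module Crossings (n m : ℕ) where
  open Matchings n
  module SortedV = Sorted {n}
  open SortedE using (sorted; count; count-cons)

  crossing : Edge → Bool
  crossing e = (toℕ (end₁ e) <ᵇ m) ∧ (m ≤ᵇ toℕ (end₂ e))

  cross≡count : ∀ l → cross n m l ≡ count crossing l
  cross≡count []      = refl
  cross≡count (e ∷ l) = trans (cong (_ +_) (cross≡count l)) (sym (count-cons crossing e l))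

  crossingEdges : ∀ {k} → Vec (Fin n) k → Vec (Fin n) k → List Edge
  crossingEdges []      []      = []
  crossingEdges (a ∷ A) (b ∷ B) = edgeOf a b ∷ crossingEdges A B

  record IsValidPair {k} (A B : Vec (Fin n) k) : Set where
    field
      A-increasing : T (incr A)
      A-left       : T (allV (λ a → toℕ a <ᵇ m) A)
      B-right      : T (allV (λ b → m ≤ᵇ toℕ b) B)
      B-distinct   : T (distinct B)

  validPair : ∀ {k} (A B : Vec (Fin n) k) → ValidAB n m (A , B) → IsValidPair A B
  validPair A B t = record
    { A-increasing = ∧-fst t
    ; A-left       = ∧-fst (∧-snd {incr A} t)
    ; B-right      = ∧-fst (∧-snd {allV (λ a → toℕ a <ᵇ m) A} (∧-snd {incr A} t))
    ; B-distinct   = ∧-snd {allV (λ b → m ≤ᵇ toℕ b) B} (∧-snd {allV (λ a → toℕ a <ᵇ m) A} (∧-snd {incr A} t)) }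

  validAB : ∀ {k} (A B : Vec (Fin n) k) → IsValidPair A B → ValidAB n m (A , B)
  validAB A B v = ∧-intro A-increasing (∧-intro A-left (∧-intro B-right B-distinct))
    where open IsValidPair v

  tail-valid : ∀ {k} {a b} {A B : Vec (Fin n) k} → IsValidPair (a ∷ A) (b ∷ B) → IsValidPair A B
  tail-valid {a = a} {b} {A} v = record
    { A-increasing = SortedV.tail-increasing A (IsValidPair.A-increasing v)
    ; A-left       = ∧-snd {toℕ a <ᵇ m} (IsValidPair.A-left v)
    ; B-right      = ∧-snd {m ≤ᵇ toℕ b} (IsValidPair.B-right v)
    ; B-distinct   = ∧-snd (IsValidPair.B-distinct v) }

  A-sorted : ∀ {k} {A B : Vec (Fin n) k} → IsValidPair A B → T (SortedV.sorted (toList A))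
  A-sorted {A = A} v =
    subst T (trans (SortedV.increasing-toList A) (SortedV.increasing≡sorted (toList A))) (IsValidPair.A-increasing v)

  head-left : ∀ {k a b} {A B : Vec (Fin n) k} → IsValidPair (a ∷ A) (b ∷ B) → toℕ a < m
  head-left {a = a} {A = A} v =
    ℕP.<ᵇ⇒< (toℕ a) m (∧-fst {toℕ a <ᵇ m} {allV (λ a → toℕ a <ᵇ m) A} (IsValidPair.A-left v))

  head-right : ∀ {k a b} {A B : Vec (Fin n) k} → IsValidPair (a ∷ A) (b ∷ B) → m ≤ toℕ b
  head-right {b = b} {B = B} v =
    ℕP.≤ᵇ⇒≤ m (toℕ b) (∧-fst {m ≤ᵇ toℕ b} {allV (λ b → m ≤ᵇ toℕ b) B} (IsValidPair.B-right v))

  head-fresh : ∀ {k a b} {A B : Vec (Fin n) k} → IsValidPair (a ∷ A) (b ∷ B) → T (not (elem b B))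
  head-fresh {b = b} {B = B} v = ∧-fst {not (elem b B)} (IsValidPair.B-distinct v)

  length-crossingEdges : ∀ {k} (A B : Vec (Fin n) k) → length (crossingEdges A B) ≡ k
  length-crossingEdges []      []      = refl
  length-crossingEdges (a ∷ A) (b ∷ B) = cong suc (length-crossingEdges A B)

  map-end₁-crossingEdges : ∀ {k} (A B : Vec (Fin n) k) → map end₁ (crossingEdges A B) ≡ toList A
  map-end₁-crossingEdges []      []      = refl
  map-end₁-crossingEdges (a ∷ A) (b ∷ B) = cong₂ _∷_ (end₁-edgeOf a b) (map-end₁-crossingEdges A B)

  map-end₂-crossingEdges : ∀ {k} (A B : Vec (Fin n) k) → map end₂ (crossingEdges A B) ≡ toList B
  map-end₂-crossingEdges []      []      = refl
  map-end₂-crossingEdges (a ∷ A) (b ∷ B) = cong₂ _∷_ (end₂-edgeOf a b) (map-end₂-crossingEdges A B)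

  crossingEdges-ends : ∀ {k} (A B : Vec (Fin n) k) (L : List Edge) →
                       toList A ≡ map end₁ L → toList B ≡ map end₂ L → crossingEdges A B ≡ L
  crossingEdges-ends []      []      []      _  _  = refl
  crossingEdges-ends (a ∷ A) (b ∷ B) (e ∷ L) hA hB =
    cong₂ _∷_ (trans (cong₂ edgeOf (ListP.∷-injectiveˡ hA) (ListP.∷-injectiveˡ hB)) (FinP.combine-remQuot {n} n e))
              (crossingEdges-ends A B L (ListP.∷-injectiveʳ hA) (ListP.∷-injectiveʳ hB))

  crossingEdges-crossing : ∀ {k} (A B : Vec (Fin n) k) → IsValidPair A B → T (all crossing (crossingEdges A B))
  crossingEdges-crossing []      []      v = tt
  crossingEdges-crossing (a ∷ A) (b ∷ B) v =
    ∧-intro (subst T (sym (cong₂ (λ x y → (toℕ x <ᵇ m) ∧ (m ≤ᵇ toℕ y)) (end₁-edgeOf a b) (end₂-edgeOf a b)))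
                     (∧-intro (ℕP.<⇒<ᵇ (head-left v)) (ℕP.≤⇒≤ᵇ (head-right v))))
            (crossingEdges-crossing A B (tail-valid v))

  crossingEdges-sorted : ∀ {k} (A B : Vec (Fin n) k) → T (SortedV.sorted (toList A)) → T (sorted (crossingEdges A B))
  crossingEdges-sorted []      []      t = tt
  crossingEdges-sorted (a ∷ A) (b ∷ B) t =
    ∧-intro (first A B (∧-fst t)) (crossingEdges-sorted A B (∧-snd {all (lt a) (toList A)} t))
    where
    first : ∀ {k} (A B : Vec (Fin n) k) → T (all (lt a) (toList A)) → T (all (lt (edgeOf a b)) (crossingEdges A B))
    first []        []        t = tt
    first (a' ∷ A) (b' ∷ B) t =
      ∧-intro (<⇒lt (edgeOf a b) (edgeOf a' b') (FinP.combine-monoˡ-< b b' (lt⇒< a a' (∧-fst t))))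
              (first A B (∧-snd {lt a a'} t))

  private
    edgeOf-disjoint : ∀ a b a' b' → toℕ a < toℕ a' → toℕ a' < m → m ≤ toℕ b → m ≤ toℕ b' →
                      T (not (toℕ b == toℕ b')) → T (disjoint (edgeOf a b) (edgeOf a' b'))
    edgeOf-disjoint a b a' b' a<a' a'<m m≤b m≤b' b≢b'
      rewrite end₁-edgeOf a b | end₂-edgeOf a b | end₁-edgeOf a' b' | end₂-edgeOf a' b'
            | <⇒==-false a<a' | <⇒==-false (ℕP.<-≤-trans (ℕP.<-trans a<a' a'<m) m≤b')
            | ==-sym (toℕ b) (toℕ a') | <⇒==-false (ℕP.<-≤-trans a'<m m≤b) | ¬T→≡ (not-elim b≢b') = tt

  crossingEdges-matching : ∀ {k} (A B : Vec (Fin n) k) → IsValidPair A B → T (isMatching n (crossingEdges A B))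
  crossingEdges-matching []      []      v = tt
  crossingEdges-matching (a ∷ A) (b ∷ B) v =
    ∧-intro (subst T (sym (cong₂ lt (end₁-edgeOf a b) (end₂-edgeOf a b))) (<⇒lt a b (ℕP.<-≤-trans a<m m≤b)))
      (∧-intro (rest A B (tail-valid v) (∧-fst (A-sorted v)) (head-fresh v))
               (crossingEdges-matching A B (tail-valid v)))
    where
    a<m = head-left v
    m≤b = head-right v
    rest : ∀ {k} (A B : Vec (Fin n) k) → IsValidPair A B → T (all (lt a) (toList A)) → T (not (elem b B)) →
           T (all (disjoint (edgeOf a b)) (crossingEdges A B))
    rest []        []        w s d = tt
    rest (a' ∷ A) (b' ∷ B) w s d =
      ∧-intro (edgeOf-disjoint a b a' b' (lt⇒< a a' (∧-fst s)) (head-left w) m≤b (head-right w)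
                               (not-intro (λ b≡b' → not-elim d (∨-inl b≡b'))))
              (rest A B (tail-valid w) (∧-snd {lt a a'} s) (not-intro (λ u → not-elim d (∨-inr (toℕ b == toℕ b') u))))

  private
    elemL : Fin n → List (Fin n) → Bool
    elemL x []      = false
    elemL x (y ∷ l) = (toℕ x == toℕ y) ∨ elemL x l

    distinctL : List (Fin n) → Bool
    distinctL []      = true
    distinctL (x ∷ l) = not (elemL x l) ∧ distinctL l

    elem-toList : ∀ {k} x (v : Vec (Fin n) k) → elem x v ≡ elemL x (toList v)
    elem-toList x []      = refl
    elem-toList x (y ∷ v) = cong ((toℕ x == toℕ y) ∨_) (elem-toList x v)

    distinct-toList : ∀ {k} (v : Vec (Fin n) k) → distinct v ≡ distinctL (toList v)
    distinct-toList []      = refl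
    distinct-toList (x ∷ v) = cong₂ (λ a b → not a ∧ b) (elem-toList x v) (distinct-toList v)

    end₁-mono : ∀ x y → T (lt x y) → T (disjoint x y) → T (lt (end₁ x) (end₁ y))
    end₁-mono x y x<y d = <⇒lt (end₁ x) (end₁ y) (ℕP.≤∧≢⇒< end₁x≤end₁y
      (λ eq → not-elim d (meet-end₁ x y (≡⇒== eq))))
      where
      end₁x≤end₁y : toℕ (end₁ x) ≤ toℕ (end₁ y)
      end₁x≤end₁y = ℕP.≮⇒≥ (λ y<x → ℕP.<-asym (lt⇒< x y x<y)
        (subst₂ (λ a b → toℕ a < toℕ b) (FinP.combine-remQuot {n} n y) (FinP.combine-remQuot {n} n x)
                (FinP.combine-monoˡ-< (end₂ y) (end₂ x) y<x)))

    sorted-end₁ : ∀ L → T (sorted L) → T (isMatching n L) → T (SortedV.sorted (map end₁ L))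
    sorted-end₁ []      s t = tt
    sorted-end₁ (x ∷ L) s t =
      ∧-intro (subst T (sym (all-map (lt (end₁ x)) end₁ L))
                 (all-mono (λ y h → end₁-mono x y (∧-fst h) (∧-snd {lt x y} h)) L
                           (all-∧ L (∧-fst s) (∧-fst {all (disjoint x) L} (∧-snd {isEdge n x} t)))))
              (sorted-end₁ L (∧-snd {all (lt x) L} s) (∧-snd {all (disjoint x) L} (∧-snd {isEdge n x} t)))

    distinct-end₂ : ∀ L → T (isMatching n L) → T (distinctL (map end₂ L))
    distinct-end₂ []      t = tt
    distinct-end₂ (x ∷ L) t =
      ∧-intro (not-intro (fresh L (∧-fst {all (disjoint x) L} (∧-snd {isEdge n x} t))))
              (distinct-end₂ L (∧-snd {all (disjoint x) L} (∧-snd {isEdge n x} t)))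
      where
      fresh : ∀ L → T (all (disjoint x) L) → ¬ T (elemL (end₂ x) (map end₂ L))
      fresh (y ∷ L) d u with Equivalence.to T-∨ u
      ... | inj₁ same  = not-elim (∧-fst {disjoint x y} d) (meet-end₂ x y same)
      ... | inj₂ later = fresh L (∧-snd {disjoint x y} d) later

  ends-valid : ∀ {k} (L : List Edge) (A B : Vec (Fin n) k) → toList A ≡ map end₁ L → toList B ≡ map end₂ L →
               T (sorted L) → T (isMatching n L) → T (all crossing L) → IsValidPair A B
  ends-valid L A B tA tB s t c = record
    { A-increasing = subst T (sym (trans (SortedV.increasing-toList A)
                       (trans (cong SortedV.increasing tA) (SortedV.increasing≡sorted (map end₁ L)))))
                       (sorted-end₁ L s t)
    ; A-left       = subst T (sym (trans (allV-toList _ A) (trans (cong (all _) tA) (all-map _ end₁ L))))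
                       (all-mono (λ e h → ∧-fst h) L c)
    ; B-right      = subst T (sym (trans (allV-toList _ B) (trans (cong (all _) tB) (all-map _ end₂ L))))
                       (all-mono (λ e h → ∧-snd {toℕ (end₁ e) <ᵇ m} h) L c)
    ; B-distinct   = subst T (sym (trans (distinct-toList B) (cong distinctL tB))) (distinct-end₂ L t) }

  inLeft inRight : ∀ {k} → Vec (Fin n) k → Fin n → Bool
  inLeft  A x = (toℕ x <ᵇ m) ∧ not (elem x A)
  inRight B x = (m ≤ᵇ toℕ x) ∧ not (elem x B)

  joinEdge : ∀ {k} → Vec (Fin n) k → Vec (Fin n) k → Edge → Bool
  joinEdge A B e = (inLeft A (end₁ e) ∧ inLeft A (end₂ e)) ∨ (inRight B (end₁ e) ∧ inRight B (end₂ e))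

  hits : ∀ {k} → Vec (Fin n) k → Vec (Fin n) k → Edge → Bool
  hits A B e = elem (end₁ e) A ∨ elem (end₂ e) A ∨ elem (end₁ e) B ∨ elem (end₂ e) B

  disjoint-crossingEdges : ∀ {k} (A B : Vec (Fin n) k) e →
                           all (λ s → disjoint s e) (crossingEdges A B) ≡ not (hits A B e)
  disjoint-crossingEdges []      []      e = refl
  disjoint-crossingEdges (a ∷ A) (b ∷ B) e = begin
    disjoint (edgeOf a b) e ∧ all (λ s → disjoint s e) (crossingEdges A B)
      ≡⟨ cong₂ _∧_ (cong₂ (λ x y → not ((toℕ x == q) ∨ (toℕ x == r) ∨ (toℕ y == q) ∨ (toℕ y == r)))
                          (end₁-edgeOf a b) (end₂-edgeOf a b))
                   (disjoint-crossingEdges A B e) ⟩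
    not ((a' == q) ∨ (a' == r) ∨ (b' == q) ∨ (b' == r)) ∧ not (hits A B e)
      ≡⟨ not-∨ ((a' == q) ∨ (a' == r) ∨ (b' == q) ∨ (b' == r)) (hits A B e) ⟨
    not (((a' == q) ∨ (a' == r) ∨ (b' == q) ∨ (b' == r)) ∨ hits A B e)
      ≡⟨ cong (λ z → not (z ∨ hits A B e)) (cong₂ _∨_ (==-sym a' q) (cong₂ _∨_ (==-sym a' r)
                                              (cong₂ _∨_ (==-sym b' q) (==-sym b' r)))) ⟩
    not (((q == a') ∨ (r == a') ∨ (q == b') ∨ (r == b')) ∨ hits A B e)
      ≡⟨ cong not (∨-Solver.solve 8 (λ w x y z W X Y Z →
                     (w ⊕ (x ⊕ (y ⊕ z))) ⊕ (W ⊕ (X ⊕ (Y ⊕ Z))) ⊜ (w ⊕ W) ⊕ ((x ⊕ X) ⊕ ((y ⊕ Y) ⊕ (z ⊕ Z)))) refl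
                     (q == a') (r == a') (q == b') (r == b')
                     (elem (end₁ e) A) (elem (end₂ e) A) (elem (end₁ e) B) (elem (end₂ e) B)) ⟩
    not (hits (a ∷ A) (b ∷ B) e) ∎
    where
    open ≡-Reasoning
    open ∨-Solver using (_⊕_; _⊜_)
    q = toℕ (end₁ e) ; r = toℕ (end₂ e) ; a' = toℕ a ; b' = toℕ b

  left∉B : ∀ {k} {A B : Vec (Fin n) k} → IsValidPair A B → ∀ x → toℕ x < m → elem x B ≡ false
  left∉B {A = []}    {[]}    v x x<m = refl
  left∉B {A = _ ∷ _} {b ∷ B} v x x<m =
    cong₂ _∨_ (<⇒==-false (ℕP.<-≤-trans x<m (head-right v))) (left∉B (tail-valid v) x x<m)

  right∉A : ∀ {k} {A B : Vec (Fin n) k} → IsValidPair A B → ∀ x → m ≤ toℕ x → elem x A ≡ false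
  right∉A {A = []}    {[]}    v x m≤x = refl
  right∉A {A = a ∷ A} {_ ∷ _} v x m≤x =
    cong₂ _∨_ (trans (==-sym (toℕ x) (toℕ a)) (<⇒==-false (ℕP.<-≤-trans (head-left v) m≤x))) (right∉A (tail-valid v) x m≤x)

  joinEdge-char : ∀ {k} (A B : Vec (Fin n) k) → IsValidPair A B → ∀ e → T (isEdge n e) →
                  joinEdge A B e ≡ not (hits A B e) ∧ not (crossing e)
  joinEdge-char A B v e edge-e
    rewrite ≤ᵇ≡not<ᵇ m (toℕ (end₁ e)) | ≤ᵇ≡not<ᵇ m (toℕ (end₂ e))
    with T? (toℕ (end₁ e) <ᵇ m) | T? (toℕ (end₂ e) <ᵇ m)
  ... | yes e₁<m | yes e₂<m
    rewrite T→≡ e₁<m | T→≡ e₂<m | left∉B v (end₁ e) (ℕP.<ᵇ⇒< _ m e₁<m) | left∉B v (end₂ e) (ℕP.<ᵇ⇒< _ m e₂<m)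
    = both-avoid (elem (end₁ e) A) (elem (end₂ e) A)
    where
    both-avoid : ∀ x y → (not x ∧ not y) ∨ false ≡ not (x ∨ y ∨ false ∨ false) ∧ true
    both-avoid true  y     = refl
    both-avoid false true  = refl
    both-avoid false false = refl
  ... | yes e₁<m | no e₂≮m rewrite T→≡ e₁<m | ¬T→≡ e₂≮m =
    trans (neither (elem (end₁ e) A) (not (elem (end₂ e) A))) (sym (∧-zeroʳ (not (hits A B e))))
    where
    neither : ∀ x y → (not x ∧ (false ∧ y)) ∨ false ≡ false
    neither true  y = refl
    neither false y = refl
  ... | no e₁≮m  | yes e₂<m =
    ⊥-elim (e₁≮m (ℕP.<⇒<ᵇ (ℕP.<-trans (lt⇒< (end₁ e) (end₂ e) edge-e) (ℕP.<ᵇ⇒< _ m e₂<m))))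
  ... | no e₁≮m  | no e₂≮m
    rewrite ¬T→≡ e₁≮m | ¬T→≡ e₂≮m
          | right∉A v (end₁ e) (ℕP.≮⇒≥ (λ u → e₁≮m (ℕP.<⇒<ᵇ u))) | right∉A v (end₂ e) (ℕP.≮⇒≥ (λ u → e₂≮m (ℕP.<⇒<ᵇ u)))
    = both-avoid (elem (end₁ e) B) (elem (end₂ e) B)
    where
    both-avoid : ∀ x y → (not x ∧ not y) ≡ not (false ∨ false ∨ x ∨ y) ∧ true
    both-avoid true  y     = refl
    both-avoid false true  = refl
    both-avoid false false = refl

module Faces (n m i : ℕ) where
  open Matchings n
  open Crossings n m
  open SortedE using (sorted; count; increasing-toList; increasing≡sorted)
  open Int using (+_)

  relativeFace : ∀ {K} → Vec Edge K → Bool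
  relativeFace σ = incr σ ∧ Δ n m (+ i) (toList σ) ∧ not (Δ n m (+ i Int.- + 1) (toList σ))

  joinFace : ∀ {k j} → Vec (Fin n) k → Vec (Fin n) k → Vec Edge j → Bool
  joinFace A B ρ = incr ρ ∧ Join n m A B (toList ρ) ∧ not false

  record IsRelativeFace (l : List Edge) : Set where
    field
      sorted-l   : T (sorted l)
      matching-l : T (isMatching n l)
      crossings  : count crossing l ≡ i

  record IsJoinFace {k} (A B : Vec (Fin n) k) (l : List Edge) : Set where
    field
      sorted-l   : T (sorted l)
      matching-l : T (isMatching n l)
      joinEdges  : T (all (joinEdge A B) l)

  private
    below-i⇒ : ∀ x i → T (+ x Int.≤ᵇ (+ i Int.- + 1)) → x < i
    below-i⇒ x (suc i) t = s≤s (ℕP.≤ᵇ⇒≤ x i t)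

    ⇒below-i : ∀ x i → x < i → T (+ x Int.≤ᵇ (+ i Int.- + 1))
    ⇒below-i x (suc i) (s≤s x≤i) = ℕP.≤⇒≤ᵇ x≤i

  relativeFace⇒ : ∀ {K} (σ : Vec Edge K) → T (relativeFace σ) → IsRelativeFace (toList σ)
  relativeFace⇒ σ t = record
    { sorted-l   = subst T (trans (increasing-toList σ) (increasing≡sorted (toList σ))) (∧-fst t)
    ; matching-l = ∧-fst in-Δ
    ; crossings  = trans (sym (cross≡count l)) (ℕP.≤-antisym (ℕP.≤ᵇ⇒≤ (cross n m l) i (∧-snd in-Δ))
                     (ℕP.≮⇒≥ (λ c<i → not-elim (∧-snd {Δ n m (+ i) l} (∧-snd {incr σ} t))
                                                (∧-intro (∧-fst in-Δ) (⇒below-i (cross n m l) i c<i))))) }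
    where
    l = toList σ
    in-Δ : T (Δ n m (+ i) l)
    in-Δ = ∧-fst (∧-snd {incr σ} t)

  ⇒relativeFace : ∀ {K} (σ : Vec Edge K) → IsRelativeFace (toList σ) → T (relativeFace σ)
  ⇒relativeFace σ f = ∧-intro
    (subst T (sym (trans (increasing-toList σ) (increasing≡sorted (toList σ)))) sorted-l)
    (∧-intro (∧-intro matching-l (ℕP.≤⇒≤ᵇ (ℕP.≤-reflexive c≡i)))
             (not-intro (λ u → ℕP.<-irrefl c≡i (below-i⇒ (cross n m (toList σ)) i (∧-snd u)))))
    where
    open IsRelativeFace f
    c≡i : cross n m (toList σ) ≡ i
    c≡i = trans (cross≡count (toList σ)) crossings

  joinFace⇒ : ∀ {k j} (A B : Vec (Fin n) k) (ρ : Vec Edge j) → T (joinFace A B ρ) → IsJoinFace A B (toList ρ)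
  joinFace⇒ A B ρ t = record
    { sorted-l   = subst T (trans (increasing-toList ρ) (increasing≡sorted (toList ρ))) (∧-fst t)
    ; matching-l = ∧-fst in-J
    ; joinEdges  = ∧-snd {isMatching n (toList ρ)} in-J }
    where
    in-J : T (Join n m A B (toList ρ))
    in-J = ∧-fst (∧-snd {incr ρ} t)

  ⇒joinFace : ∀ {k j} (A B : Vec (Fin n) k) (ρ : Vec Edge j) → IsJoinFace A B (toList ρ) → T (joinFace A B ρ)
  ⇒joinFace A B ρ f = ∧-intro (subst T (sym (trans (increasing-toList ρ) (increasing≡sorted (toList ρ)))) sorted-l)
                              (∧-intro {Join n m A B (toList ρ)} (∧-intro matching-l joinEdges) tt)
    where open IsJoinFace f

  module Union {A B : Vec (Fin n) i} (v : IsValidPair A B) where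
    open SortedE using (insertAll; count-insertAll; sorted-insertAll⁻; sorted-insertAll⁺)

    S : List Edge
    S = crossingEdges A B

    S-count : count crossing S ≡ i
    S-count = trans (length-filter-all crossing S (crossingEdges-crossing A B v)) (length-crossingEdges A B)

    joinEdge-S : ∀ e → T (isEdge n e) → joinEdge A B e ≡ all (λ s → disjoint s e) S ∧ not (crossing e)
    joinEdge-S e t = trans (joinEdge-char A B v e t) (cong (_∧ not (crossing e)) (sym (disjoint-crossingEdges A B e)))

    union⇒join : ∀ l → IsRelativeFace (insertAll S l) → IsJoinFace A B l
    union⇒join l f = record
      { sorted-l   = sorted-insertAll⁻ S l sorted-l
      ; matching-l = matching
      ; joinEdges  = all-mono (λ e h → subst T (sym (joinEdge-S e (∧-fst {isEdge n e} h))) (∧-snd {isEdge n e} h)) l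
                       (all-∧ l (matching-edges l matching) (all-∧ l disjoint-S non-crossing)) }
      where
      open IsRelativeFace f
      parts : T (isMatching n S ∧ (isMatching n l ∧ allDisjoint S l))
      parts = subst T (isMatching-insertAll S l) matching-l
      matching : T (isMatching n l)
      matching = ∧-fst (∧-snd {isMatching n S} parts)
      disjoint-S : T (all (λ e → all (λ s → disjoint s e) S) l)
      disjoint-S = subst T (all-swap disjoint S l) (∧-snd {isMatching n l} (∧-snd {isMatching n S} parts))
      -- S already accounts for all i crossing edges
      non-crossing : T (all (λ e → not (crossing e)) l)
      non-crossing = length-filter-0 crossing l (ℕP.+-cancelˡ-≡ i _ 0 (begin
        i + count crossing l                ≡⟨ cong (_+ count crossing l) S-count ⟨
        count crossing S + count crossing l ≡⟨ count-insertAll crossing S l ⟨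
        count crossing (insertAll S l)      ≡⟨ crossings ⟩
        i                                   ≡⟨ ℕP.+-identityʳ i ⟨
        i + 0                               ∎))
        where open ≡-Reasoning

    joinFace-edges : ∀ l → IsJoinFace A B l → T (all (λ e → all (λ s → disjoint s e) S ∧ not (crossing e)) l)
    joinFace-edges l f = all-mono (λ e h → subst T (joinEdge-S e (∧-fst {isEdge n e} h)) (∧-snd {isEdge n e} h)) l
                                  (all-∧ l (matching-edges l (IsJoinFace.matching-l f)) (IsJoinFace.joinEdges f))

    joinFace-non-crossing : ∀ l → IsJoinFace A B l → T (all (λ e → not (crossing e)) l)
    joinFace-non-crossing l f = all-mono (λ e h → ∧-snd {all (λ s → disjoint s e) S} h) l (joinFace-edges l f)

    join⇒union : ∀ l → IsJoinFace A B l → IsRelativeFace (insertAll S l)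
    join⇒union l f = record
      { sorted-l   = sorted-insertAll⁺ S l (crossingEdges-sorted A B (A-sorted v)) sorted-l
                       (all-mono (λ s → all-mono (disjoint⇒distinct s) l) S disjoint-S)
      ; matching-l = subst T (sym (isMatching-insertAll S l))
                       (∧-intro (crossingEdges-matching A B v) (∧-intro matching-l disjoint-S))
      ; crossings  = trans (count-insertAll crossing S l)
                       (trans (cong₂ _+_ S-count (cong length (filter-none crossing l (joinFace-non-crossing l f))))
                              (ℕP.+-identityʳ i)) }
      where
      open IsJoinFace f
      disjoint-S : T (allDisjoint S l)
      disjoint-S = subst T (sym (all-swap disjoint S l))
                     (all-mono (λ e h → ∧-fst {all (λ s → disjoint s e) S} h) l (joinFace-edges l f))

-- The default vertices z₀ and z
-- only pad vectors built from lists of the right length.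
module Correspondence {c ℓ : Level} (R : Ring c ℓ) (n m i : ℕ) (z₀ : Fin n) (z : Fin (n ℕ.* n)) where
  open Matchings n
  open Crossings n m
  open Faces n m i
  open SortedE using (sorted; count; insertAll; insertAll-↭; insertAll-insert; toList-ins; position-toList;
                      position-interleaving; interleaving; merge-filter; sorted-filter;
                      filter-insertAll-accept; filter-insertAll-reject)
  open Int using (+_)

  Pair : Set
  Pair = Vec (Fin n) i × Vec (Fin n) i

  valid? : ∀ (x : Pair) → Dec (ValidAB n m x)
  valid? x = T? _

  non-crossing : Edge → Bool
  non-crossing e = not (crossing e)

  embed : ∀ {j} → Pair → Vec Edge j → Vec Edge (j + i)
  embed {j} (A , B) ρ = fromListPad (j + i) z (insertAll (crossingEdges A B) (toList ρ))

  split : ∀ {j} → Vec Edge (j + i) → Pair × Vec Edge j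
  split {j} σ = (fromListPad i z₀ (map end₁ L) , fromListPad i z₀ (map end₂ L)) ,
                fromListPad j z (filterᵇ non-crossing (toList σ))
    where L = filterᵇ crossing (toList σ)

  twist : ∀ {j} → Pair → Vec Edge j → ℕ
  twist (A , B) ρ = interleaving (crossingEdges A B) (toList ρ)

  toList-embed : ∀ {j} (x : Pair) (ρ : Vec Edge j) →
                 toList (embed x ρ) ≡ insertAll (crossingEdges (proj₁ x) (proj₂ x)) (toList ρ)
  toList-embed {j} (A , B) ρ = toList-fromListPad (j + i) z _ (begin
    length (insertAll (crossingEdges A B) (toList ρ))       ≡⟨ ↭-length (insertAll-↭ (crossingEdges A B) (toList ρ)) ⟩
    length (crossingEdges A B ++ toList ρ)                  ≡⟨ ListP.length-++ (crossingEdges A B) ⟩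
    length (crossingEdges A B) + length (toList ρ)          ≡⟨ cong₂ _+_ (length-crossingEdges A B) (VecP.length-toList ρ) ⟩
    i + j                                                   ≡⟨ ℕP.+-comm i j ⟩
    j + i                                                   ∎)
    where open ≡-Reasoning

  module _ {A B : Vec (Fin n) i} (v : IsValidPair A B) where
    open Union v

    ok-embed : ∀ {j} (ρ : Vec Edge j) → relativeFace (embed (A , B) ρ) ≡ joinFace A B ρ
    ok-embed ρ = T-ext
      (λ t → ⇒joinFace A B ρ (union⇒join (toList ρ)
               (subst IsRelativeFace (toList-embed (A , B) ρ) (relativeFace⇒ (embed (A , B) ρ) t))))
      (λ t → ⇒relativeFace (embed (A , B) ρ)
               (subst IsRelativeFace (sym (toList-embed (A , B) ρ)) (join⇒union (toList ρ) (joinFace⇒ A B ρ t))))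

    split-embed : ∀ {j} (ρ : Vec Edge j) → T (joinFace A B ρ) → split (embed (A , B) ρ) ≡ ((A , B) , ρ)
    split-embed {j} ρ t = cong₂ _,_
      (cong₂ _,_ (ends end₁ (map-end₁-crossingEdges A B)) (ends end₂ (map-end₂-crossingEdges A B)))
      (trans (cong (fromListPad j z) (trans (cong (filterᵇ non-crossing) (toList-embed (A , B) ρ))
                                            (filter-insertAll-reject crossing S (toList ρ) S-crossing nc)))
             (fromListPad-toList z ρ))
      where
      S-crossing = crossingEdges-crossing A B v
      nc = joinFace-non-crossing (toList ρ) (joinFace⇒ A B ρ t)
      crossing-part : filterᵇ crossing (toList (embed (A , B) ρ)) ≡ S
      crossing-part = trans (cong (filterᵇ crossing) (toList-embed (A , B) ρ))
        (filter-insertAll-accept crossing S (toList ρ) (crossingEdges-sorted A B (A-sorted v)) S-crossing nc)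
      ends : ∀ (end : Edge → Fin n) {X : Vec (Fin n) i} → map end S ≡ toList X →
             fromListPad i z₀ (map end (filterᵇ crossing (toList (embed (A , B) ρ)))) ≡ X
      ends end {X} h = trans (cong (λ L → fromListPad i z₀ (map end L)) crossing-part)
                             (trans (cong (fromListPad i z₀) h) (fromListPad-toList z₀ X))

  module _ {j} (σ : Vec Edge (j + i)) (t : T (relativeFace σ)) where
    private
      f = relativeFace⇒ σ t
      open IsRelativeFace f
      l = toList σ
      L = filterᵇ crossing l
      A′ = fromListPad i z₀ (map end₁ L)
      B′ = fromListPad i z₀ (map end₂ L)
      ρ′ = fromListPad j z (filterᵇ non-crossing l)
      toList-A′ : toList A′ ≡ map end₁ L
      toList-A′ = toList-fromListPad i z₀ _ (trans (ListP.length-map end₁ L) crossings)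
      toList-B′ : toList B′ ≡ map end₂ L
      toList-B′ = toList-fromListPad i z₀ _ (trans (ListP.length-map end₂ L) crossings)
      toList-ρ′ : toList ρ′ ≡ filterᵇ non-crossing l
      toList-ρ′ = toList-fromListPad j z _ (ℕP.+-cancelʳ-≡ i _ j (begin
        length (filterᵇ non-crossing l) + i     ≡⟨ ℕP.+-comm _ i ⟩
        i + length (filterᵇ non-crossing l)     ≡⟨ cong (_+ length (filterᵇ non-crossing l)) crossings ⟨
        length L + length (filterᵇ non-crossing l) ≡⟨ length-filter-split crossing l ⟩
        length l                                ≡⟨ VecP.length-toList σ ⟩
        j + i                                   ∎))
        where open ≡-Reasoning

    split-valid : ValidAB n m (proj₁ (split {j} σ))
    split-valid = validAB A′ B′ (ends-valid L A′ B′ toList-A′ toList-B′ (sorted-filter crossing l sorted-l)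
                                   (matching-filter crossing l matching-l) (all-filter-self crossing l))

    embed-split : embed (proj₁ (split {j} σ)) (proj₂ (split {j} σ)) ≡ σ
    embed-split = toList-injective (begin
      toList (embed (A′ , B′) ρ′)               ≡⟨ toList-embed (A′ , B′) ρ′ ⟩
      insertAll (crossingEdges A′ B′) (toList ρ′) ≡⟨ cong₂ insertAll (crossingEdges-ends A′ B′ L toList-A′ toList-B′) toList-ρ′ ⟩
      insertAll L (filterᵇ non-crossing l)      ≡⟨ merge-filter crossing l sorted-l ⟩
      l                                         ∎)
      where open ≡-Reasoning

  embed-ins : ∀ {j} (x : Pair) (ρ : Vec Edge j) w → embed x (ins R w ρ) ≡ ins R w (embed x ρ)
  embed-ins x ρ w = toList-injective (begin
    toList (embed x (ins R w ρ))       ≡⟨ toList-embed x (ins R w ρ) ⟩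
    insertAll S (toList (ins R w ρ))   ≡⟨ cong (insertAll S) (toList-ins R w ρ) ⟩
    insertAll S (insert w (toList ρ))  ≡⟨ insertAll-insert S w (toList ρ) ⟩
    insert w (insertAll S (toList ρ))  ≡⟨ cong (insert w) (toList-embed x ρ) ⟨
    insert w (toList (embed x ρ))      ≡⟨ toList-ins R w (embed x ρ) ⟨
    toList (ins R w (embed x ρ))       ∎)
    where
    open ≡-Reasoning
    open SortedE using (insert)
    S = crossingEdges (proj₁ x) (proj₂ x)

  twist-ins : ∀ {j} (x : Pair) (ρ : Vec Edge j) w →
              below R w ρ + twist x (ins R w ρ) ≡ twist x ρ + below R w (embed x ρ)
  twist-ins x ρ w
    rewrite position-toList R w ρ | toList-ins R w ρ | position-toList R w (embed x ρ) | toList-embed x ρ =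
    position-interleaving (crossingEdges (proj₁ x) (proj₂ x)) w (toList ρ)

  no-small-faces : ∀ {k} (σ : Vec Edge k) → k < i → ¬ T (relativeFace σ)
  no-small-faces σ k<i t = ℕP.<⇒≱ k<i (begin
    i                                  ≡⟨ IsRelativeFace.crossings (relativeFace⇒ σ t) ⟨
    count crossing (toList σ)          ≤⟨ ListP.length-filter (λ e → T? (crossing e)) (toList σ) ⟩
    length (toList σ)                  ≡⟨ VecP.length-toList σ ⟩
    _                                  ∎)
    where open ℕP.≤-Reasoning

  open Transfer R (Δ n m (+ i)) (Δ n m (+ i Int.- + 1)) (ValidAB n m) valid?
                  (λ x → Join n m (proj₁ x) (proj₂ x)) (λ _ _ → false) i
    public using (FaceCorrespondence; homology-≅; small-vanishes)

  faceCorrespondence : FaceCorrespondence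
  faceCorrespondence = record
    { embed          = embed
    ; split          = split
    ; twist          = twist
    ; ok-embed       = λ x v ρ → ok-embed (validPair (proj₁ x) (proj₂ x) v) ρ
    ; split-embed    = λ x v ρ t → split-embed (validPair (proj₁ x) (proj₂ x) v) ρ t
    ; embed-split    = embed-split
    ; split-valid    = split-valid
    ; embed-ins      = λ x _ → embed-ins x
    ; twist-ins      = λ x _ → twist-ins x
    ; no-small-faces = no-small-faces
    }

-- Chains on K-vertex faces have degree K - 1 (Defs: `H̃ (+ d) = Hsize (suc d)`).
module Degrees where
  open Int using (+_; -[1+_]; _-_)
  open import Data.Integer.Tactic.RingSolver using (solve-∀)

  degree : ℕ → ℤ
  degree zero    = -[1+ 0 ]
  degree (suc K) = + K

  degree≡ : ∀ K → degree K ≡ + K - + 1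
  degree≡ zero    = refl
  degree≡ (suc K) = refl

  degree-shift : ∀ j i → degree (j + i) - + i ≡ degree j
  degree-shift j i = begin
    degree (j + i) - + i          ≡⟨ cong (_- + i) (trans (degree≡ (j + i)) (cong (_- + 1) (IntP.pos-+ j i))) ⟩
    ((+ j Int.+ + i) - + 1) - + i ≡⟨ solve-∀′ (+ j) (+ i) ⟩
    + j - + 1                     ≡⟨ degree≡ j ⟨
    degree j                      ∎
    where
    open ≡-Reasoning
    solve-∀′ : ∀ a b → ((a Int.+ b) - + 1) - b ≡ a - + 1
    solve-∀′ = solve-∀

  degree-below : ∀ K i → K < i → Σ ℕ (λ t → degree K - + i ≡ -[1+ suc t ])
  degree-below K i K<i = t , (begin
    degree K - + i                            ≡⟨ cong₂ _-_ (degree≡ K) (cong +_ (sym i≡1+K+t)) ⟩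
    (+ K - + 1) - + (suc K + t)               ≡⟨ cong (λ z → (+ K - + 1) - z) (IntP.pos-+ (suc K) t) ⟩
    (+ K - + 1) - (+ 1 Int.+ + K Int.+ + t)   ≡⟨ shuffle (+ K) (+ t) ⟩
    Int.- (+ 2 Int.+ + t)                     ≡⟨ cong Int.-_ (IntP.pos-+ 2 t) ⟨
    -[1+ suc t ]                              ∎)
    where
    open ≡-Reasoning
    t = i ∸ suc K
    i≡1+K+t : suc K + t ≡ i
    i≡1+K+t = ℕP.m+[n∸m]≡n K<i
    shuffle : ∀ a b → (a - + 1) - (+ 1 Int.+ a Int.+ b) ≡ Int.- (+ 2 Int.+ b)
    shuffle = solve-∀

module Main {c ℓ : Level} (R : Ring c ℓ) (n m i : ℕ) (z₀ : Fin n) (z : Fin (n ℕ.* n)) where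
  open Correspondence R n m i z₀ z using (Pair; faceCorrespondence; no-small-faces; homology-≅; small-vanishes)
  open Degrees
  open Int using (+_; -[1+_]; _-_)

  private
    module Relative = Rel R (Δ n m (+ i)) (Δ n m (+ i - + 1))

  Summands : ℤ → PERModule R (c ⊔ ℓ) (c ⊔ ℓ)
  Summands d = ⨁ R Pair (ValidAB n m) (λ { (A , B) → H̃abs R (Join n m A B) d })

  H̃-degree : ∀ K → Relative.H̃ (degree K) ≡ Relative.Hsize K
  H̃-degree zero    = refl
  H̃-degree (suc K) = refl

  at-size : ∀ K → _≅_ R (Relative.H̃ (degree K)) (Summands (degree K - + i))
  at-size K with i ℕP.≤? K
  ... | yes i≤K = subst (λ K → _≅_ R (Relative.H̃ (degree K)) (Summands (degree K - + i)))
                        (ℕP.m∸n+n≡m i≤K) (shifted (K ∸ i))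
    where
    aligned : ∀ j → _≅_ R (Relative.Hsize (j + i)) (Summands (degree j))
    aligned zero    = homology-≅ faceCorrespondence zero
    aligned (suc j) = homology-≅ faceCorrespondence (suc j)
    shifted : ∀ j → _≅_ R (Relative.H̃ (degree (j + i))) (Summands (degree (j + i) - + i))
    shifted j = subst₂ (_≅_ R) (sym (H̃-degree (j + i))) (cong Summands (sym (degree-shift j i))) (aligned j)
  ... | no i≰K = subst₂ (_≅_ R) (sym (H̃-degree K)) (cong Summands (sym (proj₂ (degree-below K i K<i))))
                        (small-vanishes no-small-faces K K<i)
    where K<i = ℕP.≰⇒> i≰K

  negative : ∀ t → _≅_ R (Relative.H̃ -[1+ suc t ]) (Summands (-[1+ suc t ] - + i))
  negative t = subst (λ d → _≅_ R (Relative.H̃ -[1+ suc t ]) (Summands d))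
                     (sym (proj₂ (shift-negative i))) (trivial-≅ {proj₁ (shift-negative i)})
    where
    shift-negative : ∀ i → Σ ℕ (λ u → -[1+ suc t ] - + i ≡ -[1+ suc u ])
    shift-negative zero    = t , refl
    shift-negative (suc i) = suc t + i , refl
    trivial-≅ : ∀ {u} → _≅_ R (Relative.H̃ -[1+ suc t ]) (Summands -[1+ suc u ])
    trivial-≅ = record
      { to = λ _ _ → _ ; from = λ _ → _ ; to-cong = λ _ _ _ → _ ; from-cong = λ _ → _
      ; from-to = λ _ → _ ; to-from = λ _ _ _ → _ ; to-⊕ = λ _ _ _ _ → _ ; to-· = λ _ _ _ _ → _ }

open Int using (+_; -[1+_]; _-_)

lemma2p1 : ∀ {c ℓ : Level} (R : Ring c ℓ) (n m i : ℕ) →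
    1 ≤ m → m ≤ n → i ≤ m ⊓ (n ∸ m) → (d : ℤ) →
    _≅_ R (Rel.H̃ R (Δ n m (+ i)) (Δ n m (+ i - + 1)) d)
          (⨁ R (Vec (Fin n) i × Vec (Fin n) i) (ValidAB n m)
               (λ { (A , B) → H̃abs R (Join n m A B) (d - + i) }))
lemma2p1 R zero    zero    i () _  _ d
lemma2p1 R zero    (suc m) i _  () _ d
lemma2p1 R (suc n) m i _ _ _ (+ d)          = Main.at-size R (suc n) m i Fin.zero Fin.zero (suc d)
lemma2p1 R (suc n) m i _ _ _ -[1+ zero ]    = Main.at-size R (suc n) m i Fin.zero Fin.zero zero
lemma2p1 R (suc n) m i _ _ _ -[1+ suc t ]   = Main.negative R (suc n) m i Fin.zero Fin.zero t
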